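{- Let $D$ be a digraph on vertex set $[n]$ with adjacency matrix $A$, let $\overline{A}=\vec{1}\vec{1}^T-A$ be the adjacency matrix of its complement $\overline{D}$, and let $X=\mathrm{diag}(x_1,\ldots,x_n)$. Then, in $\mathbb{Q}[x_1,\ldots,x_n][[z]]$, $$W_D(z)=\frac{\det(I+zX\overline{A})}{\det(I-zXA)}.$$ Consequently $W_{\overline{D}}(z)=(W_D(-z))^{ -1}$, and if $D$ is acyclic then $W_D(z)=\det(I+zX\overline{A})$.
   Context: A digraph on $[n]$ has a set of directed edges $E\subseteq[n]\times[n]$ (loops $(i,i)$ allowed, no parallel edges). The adjacency matrix $A$ has $(i,j)$-entry $1$ iff $(i,j)\in E$, else $0$. The complement $\overline{D}$ has edge $(u,v)$ (including $u=v$) iff $(u,v)$ is not an edge of $D$; $\vec 1$ is the all-ones column vector. A walk of length $k\ge 0$ is a sequence $(i_0,\ldots,i_k)$ of vertices with each $(i_j,i_{j+1})$ an edge. The walk generating function is $W_D(z)=\sum_{k\ge0}\gamma_k(D)z^k$ where $\gamma_0(D)=1$ and $\gamma_{k+1}(D)=\sum x_{i_0}x_{i_1}\cdots x_{i_k}$, summed over all walks $(i_0,\ldots,i_k)$ of length $k$ in $D$. A digraph is acyclic if it has no directed cycles (including loops). -}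

module Defs where

open import Level using (_⊔_)
open import Algebra.Bundles using (CommutativeRing)
open import Data.Nat using (ℕ; zero; suc; _∸_)
open import Data.Fin using (Fin; zero; suc; punchIn; inject₁; fromℕ)
open import Data.Bool using (Bool; true; false; not; _∧_; if_then_else_)
open import Data.Vec using (Vec; []; _∷_)
open import Data.List using (List; []; _∷_; [_]; map; concatMap; allFin; foldr)
open import Data.Product using (Σ; _×_)
open import Relation.Binary.PropositionalEquality using (_≡_)
open import Relation.Nullary using (¬_; does)
open import Data.Fin using (_≟_; toℕ)

-- Digraphs on [n] = Fin n: loops allowed, no parallel edges.
-- D i j ≡ true  iff  (i , j) is an edge.

Digraph : ℕ → Set
Digraph n = Fin n → Fin n → Bool

Edge : ∀ {n} → Digraph n → Fin n → Fin n → Set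
Edge D i j = D i j ≡ true

-- complement: (u,v) edge of D̄ iff not an edge of D (including u = v)
complement : ∀ {n} → Digraph n → Digraph n
complement D i j = not (D i j)

-- A directed cycle of length m+1 ≥ 1 (a loop when m = 0):
-- vertices c 0, …, c m pairwise distinct, c (m+1) = c 0,
-- and (c t , c (t+1)) an edge for every t ≤ m.
record DirectedCycle {n} (D : Digraph n) : Set where
  field
    m       : ℕ
    c       : Fin (suc (suc m)) → Fin n
    closed  : c zero ≡ c (fromℕ (suc m))
    edges   : ∀ (t : Fin (suc m)) → Edge D (c (inject₁ t)) (c (suc t))
    distinct : ∀ (s t : Fin (suc m)) → c (inject₁ s) ≡ c (inject₁ t) → s ≡ t

Acyclic : ∀ {n} → Digraph n → Set
Acyclic D = ¬ DirectedCycle D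

allVecs : ∀ n m → List (Vec (Fin n) m)
allVecs n zero    = [ [] ]
allVecs n (suc m) = concatMap (λ i → map (i ∷_) (allVecs n m)) (allFin n)

isWalk : ∀ {n m} → Digraph n → Vec (Fin n) m → Bool
isWalk D []            = true
isWalk D (i ∷ [])      = true
isWalk D (i ∷ j ∷ vs)  = D i j ∧ isWalk D (j ∷ vs)

-- Everything over an arbitrary commutative ring R (the identity is one
-- with integer coefficients in the x_i, so it holds in ℚ[x₁,…,xₙ] iff it
-- holds for every commutative ring R and every x : Fin n → R).

module PS {c ℓ} (R : CommutativeRing c ℓ) where
  open CommutativeRing R using (Carrier; _≈_; _+_; _*_; -_; 0#; 1#)

  sumFin : ∀ n → (Fin n → Carrier) → Carrier
  sumFin zero    f = 0#
  sumFin (suc n) f = f zero + sumFin n (λ i → f (suc i))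

  alt : ℕ → Carrier → Carrier
  alt zero    a = a
  alt (suc k) a = - alt k a

  module Det {A : Set c} (z0 o1 : A) (_⊞_ _⊠_ : A → A → A) (neg : A → A) where
    sgn : ℕ → A → A
    sgn zero    a = a
    sgn (suc k) a = neg (sgn k a)

    Σᶠ : ∀ n → (Fin n → A) → A
    Σᶠ zero    f = z0
    Σᶠ (suc n) f = f zero ⊞ Σᶠ n (λ i → f (suc i))

    det : ∀ n → (Fin n → Fin n → A) → A
    det zero    M = o1
    det (suc n) M = Σᶠ (suc n) (λ j →
      sgn (toℕ j) (M zero j ⊠ det n (λ r s → M (suc r) (punchIn j s))))

  PowerSeries : Set c
  PowerSeries = ℕ → Carrier

  _≋_ : PowerSeries → PowerSeries → Set ℓ
  f ≋ g = ∀ k → f k ≈ g k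

  sumUpTo : ℕ → (ℕ → Carrier) → Carrier
  sumUpTo zero    f = f zero
  sumUpTo (suc k) f = sumUpTo k f + f (suc k)

  _⊕_ : PowerSeries → PowerSeries → PowerSeries
  (f ⊕ g) k = f k + g k

  _⊗_ : PowerSeries → PowerSeries → PowerSeries
  (f ⊗ g) k = sumUpTo k (λ i → f i * g (k ∸ i))

  ⊖_ : PowerSeries → PowerSeries
  (⊖ f) k = - f k

  const : Carrier → PowerSeries
  const a zero    = a
  const a (suc k) = 0#

  𝟘 𝟙 zPS : PowerSeries
  𝟘 k = 0#
  𝟙 = const 1#
  zPS zero          = 0#
  zPS (suc zero)    = 1#
  zPS (suc (suc k)) = 0#

  atNegZ : PowerSeries → PowerSeries
  atNegZ f k = alt k (f k)

  detPS : ∀ n → (Fin n → Fin n → PowerSeries) → PowerSeries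
  detPS = Det.det 𝟘 𝟙 _⊕_ _⊗_ ⊖_

  adj : ∀ {n} → Digraph n → Fin n → Fin n → Carrier
  adj D i j = if D i j then 1# else 0#

  idPS : ∀ {n} → Fin n → Fin n → PowerSeries
  idPS i j = if does (i ≟ j) then 𝟙 else 𝟘

  IplusZXAbar : ∀ {n} → (Fin n → Carrier) → Digraph n → Fin n → Fin n → PowerSeries
  IplusZXAbar x D i j = idPS i j ⊕ (zPS ⊗ const (x i * adj (complement D) i j))
  IminusZXA : ∀ {n} → (Fin n → Carrier) → Digraph n → Fin n → Fin n → PowerSeries
  IminusZXA x D i j = idPS i j ⊕ (⊖ (zPS ⊗ const (x i * adj D i j)))

  prodX : ∀ {n m} → (Fin n → Carrier) → Vec (Fin n) m → Carrier
  prodX x []       = 1#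
  prodX x (i ∷ vs) = x i * prodX x vs

  -- walk generating function: γ₀ = 1, γ_{k+1} = Σ over walks (i₀,…,i_k)
  -- of length k of x_{i₀}⋯x_{i_k}
  W : ∀ {n} → (Fin n → Carrier) → Digraph n → PowerSeries
  W x D zero    = 1#
  W {n} x D (suc k) =
    foldr (λ v acc → (if isWalk D v then prodX x v else 0#) + acc) 0#
          (allVecs n (suc k))

-- Write B = I − zXA and C = I + zXĀ = B + (zX𝟏)𝟏ᵀ.  Counting walks of length k gives
-- γₖ₊₁(D) = 𝟏ᵀ(XA)ᵏX𝟏, so W_D = 1 + z ρ X𝟏 for the row ρ = Σₖ 𝟏ᵀ(XA)ᵏ zᵏ = 𝟏ᵀB⁻¹.
-- Since ρB = 𝟏ᵀ, Cramer's rule gives det (B with row l replaced by 𝟏ᵀ) = ρₗ det B, and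
-- expanding the rank-one update det (B + (zX𝟏)𝟏ᵀ) row by row yields det C = W_D det B.
-- The substitution z ↦ −z is a ring endomorphism of R[[z]] turning C into B̄ and B into C̄
-- (the matrices of D̄, whose complement is D), so W_D(−z) det C̄ = det B̄ and therefore
-- W_D̄(z) W_D(−z) det C̄ = det C̄; as det C̄ has constant term 1, it can be cancelled.
-- An acyclic D has a sink r, whose row in B is a unit vector; deleting r keeps D acyclic,
-- so det B = 1 by induction.

module Submission where

open import Defs
open import Algebra.Bundles using (CommutativeRing)
open import Algebra.Morphism.Structures using (IsRingHomomorphism)
open import Algebra.Structures using (IsCommutativeRing)
import Algebra.Construct.Pointwise as Pointwise
import Algebra.Properties.CommutativeSemigroup as CommutativeSemigroupProperties
import Algebra.Properties.Ring as RingProperties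
import Algebra.Properties.Semiring.Sum as SemiringSum
open import Data.Bool using (true; false; if_then_else_)
open import Data.Bool.Properties using (¬-not; not-involutive) renaming (_≟_ to _≟ᵇ_)
open import Data.Empty using (⊥; ⊥-elim)
open import Data.Fin using (Fin; zero; suc; toℕ; fromℕ; fromℕ<; inject₁; punchIn; _≟_)
open import Data.Fin.Properties
  using (any?; all?; ¬∀⟶∃¬; pigeonhole; punchInᵢ≢i; punchIn-injective; suc-injective;
         toℕ<n; toℕ-fromℕ; toℕ-fromℕ<; toℕ-inject₁; toℕ-injective)
open import Data.List using (List; []; _∷_; _++_; map; concat; foldr; tabulate)
open import Data.List.Properties using (map-tabulate)
import Data.Nat
open Data.Nat using (ℕ; zero; suc; _∸_; _<_; _≤_; s≤s; z≤n)
open import Data.Nat.Induction using (<-rec)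
import Data.Nat.Properties as ℕ
open import Data.Product using (∃; _×_; _,_; proj₁; proj₂)
open import Data.Vec using (Vec; _∷_)
open import Data.Vec.Functional using (updateAt)
open import Data.Vec.Functional.Properties using (updateAt-updates; updateAt-minimal; updateAt-id-local; map-updateAt)
open import Function using (_∘_)
open import Relation.Binary using (tri<; tri≈; tri>)
open import Relation.Binary.PropositionalEquality as ≡ using (_≡_; _≢_)
import Relation.Binary.Reasoning.Setoid as ≈-Reasoning
open import Relation.Nullary using (¬_; Dec; yes; no; does)
open import Relation.Nullary.Decidable using (map′; dec-true; dec-false)
open import Relation.Unary using (Decidable)

module FiniteSum {a l} (S : CommutativeRing a l) where
  open CommutativeRing S hiding (zero)
  open RingProperties ring using (-1*x≈-x)
  open SemiringSum semiring
    using (sum; sum-cong-≋; sum-remove; sum-replicate-zero; ∑-distrib-+; *-distribˡ-sum; *-distribʳ-sum)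
    renaming (∑-comm to sum-comm)
  open ≈-Reasoning setoid

  -- Opaque, so that equations between sums unify on their summands instead of
  -- being unfolded into `foldr`.
  opaque
    ∑ : ∀ n → (Fin n → Carrier) → Carrier
    ∑ n f = sum f

  infix 30 ∑
  syntax ∑ n (λ i → e) = ∑[ i < n ] e

  opaque
    unfolding ∑

    ∑-empty : (f : Fin zero → Carrier) → ∑[ i < zero ] f i ≈ 0#
    ∑-empty f = refl

    ∑-suc : ∀ {n} (f : Fin (suc n) → Carrier) → ∑[ i < suc n ] f i ≈ f zero + ∑[ i < n ] f (suc i)
    ∑-suc f = refl

    ∑-cong : ∀ {n} {f g : Fin n → Carrier} → (∀ i → f i ≈ g i) → ∑ n f ≈ ∑ n g
    ∑-cong {f = f} {g} = sum-cong-≋ {x = f} {y = g}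

    ∑-zero : ∀ {n} (f : Fin n → Carrier) → (∀ i → f i ≈ 0#) → ∑ n f ≈ 0#
    ∑-zero {n} f f≈0 = trans (sum-cong-≋ {x = f} {y = λ _ → 0#} f≈0) (sum-replicate-zero n)

    ∑-single : ∀ {n} (f : Fin n → Carrier) j → (∀ i → i ≢ j → f i ≈ 0#) → ∑ n f ≈ f j
    ∑-single {suc n} f j f≈0 = begin
      sum f                     ≈⟨ sum-remove f ⟩
      f j + sum (f ∘ punchIn j) ≈⟨ +-congˡ (∑-zero _ (λ i → f≈0 (punchIn j i) (punchInᵢ≢i j i))) ⟩
      f j + 0#                  ≈⟨ +-identityʳ _ ⟩
      f j                       ∎

    ∑-+ : ∀ {n} (f g : Fin n → Carrier) → ∑[ i < n ] (f i + g i) ≈ ∑ n f + ∑ n g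
    ∑-+ = ∑-distrib-+

    ∑-*ˡ : ∀ {n} x (f : Fin n → Carrier) → x * ∑ n f ≈ ∑[ i < n ] (x * f i)
    ∑-*ˡ = *-distribˡ-sum

    ∑-*ʳ : ∀ {n} x (f : Fin n → Carrier) → ∑ n f * x ≈ ∑[ i < n ] (f i * x)
    ∑-*ʳ = *-distribʳ-sum

    ∑-neg : ∀ {n} (f : Fin n → Carrier) → - ∑ n f ≈ ∑[ i < n ] (- f i)
    ∑-neg f = begin
      - sum f                    ≈⟨ -1*x≈-x _ ⟨
      - 1# * sum f               ≈⟨ *-distribˡ-sum _ f ⟩
      sum (λ i → - 1# * f i)     ≈⟨ sum-cong-≋ {x = λ i → - 1# * f i} {y = λ i → - f i} (-1*x≈-x ∘ f) ⟩
      sum (λ i → - f i)          ∎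

    ∑-comm : ∀ {m n} (F : Fin m → Fin n → Carrier) →
             ∑[ i < m ] ∑[ j < n ] F i j ≈ ∑[ j < n ] ∑[ i < m ] F i j
    ∑-comm = sum-comm

module Sign {a l} (S : CommutativeRing a l) where
  open CommutativeRing S hiding (zero)
  open RingProperties ring using (-‿+-comm; -‿distribʳ-*; -0#≈0#; -‿involutive)
  open FiniteSum S
  open PS S using (alt)
  open ≈-Reasoning setoid

  alt-cong : ∀ k {x y} → x ≈ y → alt k x ≈ alt k y
  alt-cong zero    x≈y = x≈y
  alt-cong (suc k) x≈y = -‿cong (alt-cong k x≈y)

  alt-+ : ∀ k x y → alt k (x + y) ≈ alt k x + alt k y
  alt-+ zero    x y = refl
  alt-+ (suc k) x y = trans (-‿cong (alt-+ k x y)) (sym (-‿+-comm _ _))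

  alt-neg : ∀ k x → alt k (- x) ≈ - alt k x
  alt-neg zero    x = refl
  alt-neg (suc k) x = -‿cong (alt-neg k x)

  alt-distribʳ-* : ∀ k x y → alt k (x * y) ≈ x * alt k y
  alt-distribʳ-* zero    x y = refl
  alt-distribʳ-* (suc k) x y = trans (-‿cong (alt-distribʳ-* k x y)) (-‿distribʳ-* _ _)

  alt-zero : ∀ k → alt k 0# ≈ 0#
  alt-zero zero    = refl
  alt-zero (suc k) = trans (-‿cong (alt-zero k)) -0#≈0#

  alt-involutive : ∀ k x → alt k (alt k x) ≈ x
  alt-involutive zero    x = refl
  alt-involutive (suc k) x = trans (-‿cong (alt-neg k _)) (trans (-‿involutive _) (alt-involutive k x))

  alt-comm : ∀ i k x → alt i (alt k x) ≈ alt k (alt i x)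
  alt-comm zero    k x = refl
  alt-comm (suc i) k x = trans (-‿cong (alt-comm i k x)) (sym (alt-neg k _))

  alt-sum : ∀ k {n} (f : Fin n → Carrier) → alt k (∑ n f) ≈ ∑[ i < n ] alt k (f i)
  alt-sum k {zero}  f = trans (alt-cong k (∑-empty f)) (trans (alt-zero k) (sym (∑-empty _)))
  alt-sum k {suc n} f = begin
    alt k (∑[ i < suc n ] f i)                    ≈⟨ alt-cong k (∑-suc f) ⟩
    alt k (f zero + ∑[ i < n ] f (suc i))          ≈⟨ alt-+ k _ _ ⟩
    alt k (f zero) + alt k (∑[ i < n ] f (suc i))  ≈⟨ +-congˡ (alt-sum k (f ∘ suc)) ⟩
    alt k (f zero) + ∑[ i < n ] alt k (f (suc i))  ≈⟨ ∑-suc _ ⟨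
    ∑[ i < suc n ] alt k (f i)                    ∎

module SignedSum {a l} (S : CommutativeRing a l) where
  open CommutativeRing S hiding (zero)
  open RingProperties ring using (-‿+-comm; -‿distribˡ-*; -‿involutive; x[y-z]≈xy-xz; ⁻¹-anti-homo‿-)
  open CommutativeSemigroupProperties *-commutativeSemigroup using (x∙yz≈y∙xz)
  open FiniteSum S
  open PS S using (alt)
  open Sign S
  open ≈-Reasoning setoid

  signedSum : ∀ {n} → (Fin n → Carrier) → Carrier
  signedSum {n} f = ∑[ j < n ] alt (toℕ j) (f j)

  signedSum-cong : ∀ {n} {f g : Fin n → Carrier} → (∀ j → f j ≈ g j) → signedSum f ≈ signedSum g
  signedSum-cong f≈g = ∑-cong (λ j → alt-cong (toℕ j) (f≈g j))

  signedSum-+ : ∀ {n} (f g : Fin n → Carrier) → signedSum (λ j → f j + g j) ≈ signedSum f + signedSum g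
  signedSum-+ f g = trans (∑-cong (λ j → alt-+ (toℕ j) _ _)) (∑-+ _ _)

  signedSum-neg : ∀ {n} (f : Fin n → Carrier) → signedSum (λ j → - f j) ≈ - signedSum f
  signedSum-neg f = trans (∑-cong (λ j → alt-neg (toℕ j) _)) (sym (∑-neg _))

  signedSum-- : ∀ {n} (f g : Fin n → Carrier) → signedSum (λ j → f j - g j) ≈ signedSum f - signedSum g
  signedSum-- f g = trans (signedSum-+ f _) (+-congˡ (signedSum-neg g))

  signedSum-*ˡ : ∀ {n} x (f : Fin n → Carrier) → x * signedSum f ≈ signedSum (λ j → x * f j)
  signedSum-*ˡ x f = trans (∑-*ˡ x _) (∑-cong (λ j → sym (alt-distribʳ-* (toℕ j) x (f j))))

  signedSum-sum : ∀ {n m} (F : Fin m → Fin n → Carrier) →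
                  signedSum (λ j → ∑[ i < m ] F i j) ≈ ∑[ i < m ] signedSum (F i)
  signedSum-sum F = trans (∑-cong (λ j → alt-sum (toℕ j) (λ i → F i j))) (∑-comm _)

  signedSum-zero : ∀ {n} (f : Fin n → Carrier) → (∀ j → f j ≈ 0#) → signedSum f ≈ 0#
  signedSum-zero f f≈0 = ∑-zero _ (λ j → trans (alt-cong (toℕ j) (f≈0 j)) (alt-zero (toℕ j)))

  signedSum-head : ∀ {n} (f : Fin (suc n) → Carrier) → signedSum f ≈ f zero - signedSum (f ∘ suc)
  signedSum-head f = trans (∑-suc _) (+-congˡ (sym (∑-neg _)))

  signedSum-single : ∀ {n} (f : Fin n → Carrier) j → (∀ i → i ≢ j → f i ≈ 0#) →
                     signedSum f ≈ alt (toℕ j) (f j)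
  signedSum-single f j f≈0 =
    ∑-single _ j (λ i i≢j → trans (alt-cong (toℕ i) (f≈0 i i≢j)) (alt-zero (toℕ i)))

  signedSum-alt : ∀ {n} k (f : Fin n → Carrier) → signedSum (λ j → alt k (f j)) ≈ alt k (signedSum f)
  signedSum-alt k f = trans (∑-cong (λ j → alt-comm (toℕ j) k (f j))) (sym (alt-sum k _))

  signedSum-combination : ∀ {n m} (x : Fin n → Carrier) (c : Fin m → Carrier) (F : Fin m → Fin n → Carrier) →
    signedSum (λ j → x j * ∑[ i < m ] (c i * F i j)) ≈ ∑[ i < m ] (c i * signedSum (λ j → x j * F i j))
  signedSum-combination {m = m} x c F = begin
    signedSum (λ j → x j * ∑[ i < m ] (c i * F i j))
      ≈⟨ signedSum-cong (λ j → trans (∑-*ˡ (x j) _) (∑-cong (λ i → x∙yz≈y∙xz _ _ _))) ⟩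
    signedSum (λ j → ∑[ i < m ] (c i * (x j * F i j)))
      ≈⟨ signedSum-sum _ ⟩
    ∑[ i < m ] signedSum (λ j → c i * (x j * F i j))
      ≈⟨ ∑-cong (λ i → signedSum-*ˡ (c i) _) ⟨
    ∑[ i < m ] (c i * signedSum (λ j → x j * F i j)) ∎

  wedge : ∀ {n} (x y : Fin (suc n) → Carrier) → Fin n → Carrier
  wedge x y k = x zero * y (suc k) - x (suc k) * y zero

  wedge-equal : ∀ {n} {x y : Fin (suc n) → Carrier} → (∀ s → x s ≈ y s) → ∀ k → wedge x y k ≈ 0#
  wedge-equal {x = x} {y} x≈y k = begin
    x zero * y (suc k) - x (suc k) * y zero ≈⟨ +-congˡ (-‿cong (*-comm _ _)) ⟩
    x zero * y (suc k) - y zero * x (suc k) ≈⟨ +-congˡ (-‿cong (*-cong (sym (x≈y zero)) (x≈y (suc k)))) ⟩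
    x zero * y (suc k) - x zero * y (suc k) ≈⟨ -‿inverseʳ _ ⟩
    0#                                      ∎

  wedge-swap : ∀ {n} (x y : Fin (suc n) → Carrier) k → wedge y x k ≈ - wedge x y k
  wedge-swap x y k = begin
    y zero * x (suc k) - y (suc k) * x zero ≈⟨ +-cong (*-comm _ _) (-‿cong (*-comm _ _)) ⟩
    x (suc k) * y zero - x zero * y (suc k) ≈⟨ ⁻¹-anti-homo‿- _ _ ⟨
    - wedge x y k                           ∎

  leadingPairs : ∀ {c} (x y : Fin (suc (suc c)) → Carrier) →
                 (Fin (suc (suc c)) → Fin (suc c) → Carrier) → Carrier
  leadingPairs x y H = signedSum (λ k → wedge x y k * H zero k)

  -- The expansion of a determinant along its first two rows x and y: a sum of the 2×2 minors
  -- of x, y against the complementary minors H, grouped by the first column of the pair.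
  pairExpansion : ∀ c (x y : Fin (suc (suc c)) → Carrier) → (Fin (suc (suc c)) → Fin (suc c) → Carrier) → Carrier
  pairExpansion zero    x y H = leadingPairs x y H
  pairExpansion (suc c) x y H = leadingPairs x y H + pairExpansion c (x ∘ suc) (y ∘ suc) (λ j k → H (suc j) (suc k))

  leadingPairs-equalRows : ∀ {c} {x y : Fin (suc (suc c)) → Carrier} H → (∀ s → x s ≈ y s) →
                           leadingPairs x y H ≈ 0#
  leadingPairs-equalRows H x≈y = signedSum-zero _ (λ k → trans (*-congʳ (wedge-equal x≈y k)) (zeroˡ _))

  leadingPairs-swap : ∀ {c} (x y : Fin (suc (suc c)) → Carrier) H → leadingPairs y x H ≈ - leadingPairs x y H
  leadingPairs-swap x y H =
    trans (signedSum-cong (λ k → trans (*-congʳ (wedge-swap x y k)) (sym (-‿distribˡ-* _ _)))) (signedSum-neg _)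

  pairExpansion-equalRows : ∀ c {x y : Fin (suc (suc c)) → Carrier} H → (∀ s → x s ≈ y s) →
                            pairExpansion c x y H ≈ 0#
  pairExpansion-equalRows zero    H x≈y = leadingPairs-equalRows H x≈y
  pairExpansion-equalRows (suc c) H x≈y =
    trans (+-cong (leadingPairs-equalRows H x≈y) (pairExpansion-equalRows c _ (x≈y ∘ suc))) (+-identityʳ 0#)

  pairExpansion-swap : ∀ c (x y : Fin (suc (suc c)) → Carrier) H → pairExpansion c y x H ≈ - pairExpansion c x y H
  pairExpansion-swap zero    x y H = leadingPairs-swap x y H
  pairExpansion-swap (suc c) x y H =
    trans (+-cong (leadingPairs-swap x y H) (pairExpansion-swap c (x ∘ suc) (y ∘ suc) _)) (-‿+-comm _ _)

  -- H j k is the minor obtained by deleting columns j and then k; deleting them in the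
  -- other order gives the same minor.
  SymmetricMinors : ∀ c → (Fin (suc (suc c)) → Fin (suc c) → Carrier) → Set l
  SymmetricMinors c H = ∀ (j k : Fin (suc c)) → toℕ j ≤ toℕ k → H (inject₁ j) k ≈ H (suc k) j

  doubleExpansion : ∀ {n} (x y : Fin (suc n) → Carrier) → (Fin (suc n) → Fin n → Carrier) → Carrier
  doubleExpansion x y H = signedSum (λ j → x j * signedSum (λ k → y (punchIn j k) * H j k))

  -- Split off the terms j = 0 and k = 0; what remains is the same expansion without column 0.
  doubleExpansion-step : ∀ {c} x y H → SymmetricMinors c H →
    doubleExpansion x y H ≈ leadingPairs x y H + doubleExpansion (x ∘ suc) (y ∘ suc) (λ j k → H (suc j) (suc k))
  doubleExpansion-step {c} x y H sym-H = begin
    doubleExpansion x y H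
      ≈⟨ signedSum-head _ ⟩
    x zero * S₀ - signedSum (λ j → x (suc j) * inner j)
      ≈⟨ +-congˡ (-‿cong (trans (signedSum-cong (λ j → trans (*-congˡ (signedSum-head _)) (x[y-z]≈xy-xz _ _ _)))
                                (signedSum-- _ _))) ⟩
    x zero * S₀ - (P - Q)
      ≈⟨ sub-sub _ _ _ ⟩
    (x zero * S₀ - P) + Q
      ≈⟨ +-congʳ leading ⟩
    leadingPairs x y H + Q ∎
    where
    S₀ P Q : Carrier
    S₀ = signedSum (λ k → y (suc k) * H zero k)
    P = signedSum (λ j → x (suc j) * (y zero * H (suc j) zero))
    Q = doubleExpansion (x ∘ suc) (y ∘ suc) (λ j k → H (suc j) (suc k))
    inner : Fin (suc c) → Carrier
    inner j = signedSum (λ k → y (punchIn (suc j) k) * H (suc j) k)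
    sub-sub : ∀ a b d → a - (b - d) ≈ (a - b) + d
    sub-sub a b d = trans (+-congˡ (trans (sym (-‿+-comm _ _)) (+-congˡ (-‿involutive d)))) (sym (+-assoc _ _ _))
    factor : ∀ p q r t h → p * (q * h) - r * (t * h) ≈ (p * q - r * t) * h
    factor p q r t h = sym (begin
      (p * q - r * t) * h          ≈⟨ distribʳ _ _ _ ⟩
      p * q * h + (- (r * t)) * h  ≈⟨ +-cong (*-assoc _ _ _) (sym (-‿distribˡ-* _ _)) ⟩
      p * (q * h) - r * t * h      ≈⟨ +-congˡ (-‿cong (*-assoc _ _ _)) ⟩
      p * (q * h) - r * (t * h)    ∎)
    leading : x zero * S₀ - P ≈ leadingPairs x y H
    leading = begin
      x zero * S₀ - P
        ≈⟨ +-cong (signedSum-*ˡ _ _) (-‿cong (signedSum-cong (λ k → *-congˡ (*-congˡ (sym (sym-H zero k z≤n)))))) ⟩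
      signedSum (λ k → x zero * (y (suc k) * H zero k)) - signedSum (λ k → x (suc k) * (y zero * H zero k))
        ≈⟨ signedSum-- _ _ ⟨
      signedSum (λ k → x zero * (y (suc k) * H zero k) - x (suc k) * (y zero * H zero k))
        ≈⟨ signedSum-cong (λ k → factor _ _ _ _ _) ⟩
      leadingPairs x y H ∎

  doubleExpansion-pairExpansion : ∀ c x y H → SymmetricMinors c H → doubleExpansion x y H ≈ pairExpansion c x y H
  doubleExpansion-pairExpansion zero x y H sym-H = begin
    doubleExpansion x y H
      ≈⟨ doubleExpansion-step x y H sym-H ⟩
    leadingPairs x y H + doubleExpansion (x ∘ suc) (y ∘ suc) _
      ≈⟨ +-congˡ (signedSum-zero _ (λ j → trans (*-congˡ (signedSum-zero _ (λ ()))) (zeroʳ _))) ⟩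
    leadingPairs x y H + 0#
      ≈⟨ +-identityʳ _ ⟩
    leadingPairs x y H ∎
  doubleExpansion-pairExpansion (suc c) x y H sym-H = begin
    doubleExpansion x y H
      ≈⟨ doubleExpansion-step x y H sym-H ⟩
    leadingPairs x y H + doubleExpansion (x ∘ suc) (y ∘ suc) H′
      ≈⟨ +-congˡ (doubleExpansion-pairExpansion c _ _ H′ (λ j k j≤k → sym-H (suc j) (suc k) (s≤s j≤k))) ⟩
    pairExpansion (suc c) x y H ∎
    where
    H′ : Fin (suc (suc c)) → Fin (suc c) → Carrier
    H′ j k = H (suc j) (suc k)

module Determinant {a l} (S : CommutativeRing a l) where
  open CommutativeRing S hiding (zero)
  open RingProperties ring using (-0#≈0#; -‿involutive)
  open CommutativeSemigroupProperties +-commutativeSemigroup using (xy∙z≈x∙zy)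
  open FiniteSum S
  open PS S using (alt)
  open Sign S
  open SignedSum S
  open ≈-Reasoning setoid

  Matrix : ℕ → Set a
  Matrix n = Fin n → Fin n → Carrier

  minor : ∀ {n} → Matrix (suc n) → Fin (suc n) → Fin (suc n) → Matrix n
  minor M i j r s = M (punchIn i r) (punchIn j s)

  det : ∀ n → Matrix n → Carrier
  det zero    M = 1#
  det (suc n) M = signedSum (λ j → M zero j * det n (minor M zero j))

  _[_]≔_ : ∀ {n m} → (Fin n → Fin m → Carrier) → Fin n → (Fin m → Carrier) → Fin n → Fin m → Carrier
  M [ i ]≔ v = updateAt M i (λ _ → v)

  replaceRow-cong : ∀ {n m} (M : Fin n → Fin m → Carrier) i {v v′} → (∀ s → v s ≈ v′ s) →
                    ∀ r s → (M [ i ]≔ v) r s ≈ (M [ i ]≔ v′) r s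
  replaceRow-cong M zero    v≈v′ zero    s = v≈v′ s
  replaceRow-cong M zero    v≈v′ (suc r) s = refl
  replaceRow-cong M (suc i) v≈v′ zero    s = refl
  replaceRow-cong M (suc i) v≈v′ (suc r) s = replaceRow-cong (M ∘ suc) i v≈v′ r s

  det-cong : ∀ n {M N : Matrix n} → (∀ i j → M i j ≈ N i j) → det n M ≈ det n N
  det-cong zero    M≈N = refl
  det-cong (suc n) M≈N =
    signedSum-cong (λ j → *-cong (M≈N zero j) (det-cong n (λ r s → M≈N (suc r) (punchIn j s))))

  det-cong-rows : ∀ n {M N : Matrix n} → (∀ i → M i ≡ N i) → det n M ≈ det n N
  det-cong-rows n M≡N = det-cong n (λ i j → reflexive (≡.cong (λ row → row j) (M≡N i)))

  minor-replaceRow-suc : ∀ {n} (M : Matrix (suc n)) i v j r →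
                         minor (M [ suc i ]≔ v) zero j r ≡ (minor M zero j [ i ]≔ (v ∘ punchIn j)) r
  minor-replaceRow-suc M i v j = map-updateAt {f = _∘ punchIn j} (λ _ → ≡.refl) (λ r → M (suc r)) i

  det-replaceRow-suc : ∀ n (M : Matrix (suc n)) i v →
    det (suc n) (M [ suc i ]≔ v) ≈ signedSum (λ j → M zero j * det n (minor M zero j [ i ]≔ (v ∘ punchIn j)))
  det-replaceRow-suc n M i v = signedSum-cong (λ j → *-congˡ (det-cong-rows n (minor-replaceRow-suc M i v j)))

  det-replaceRow-linear : ∀ n (M : Matrix n) i {m} (c : Fin m → Carrier) (V : Fin m → Fin n → Carrier) →
    det n (M [ i ]≔ (λ s → ∑[ l < m ] (c l * V l s))) ≈ ∑[ l < m ] (c l * det n (M [ i ]≔ V l))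
  det-replaceRow-linear (suc n) M zero {m} c V = begin
    signedSum (λ j → (∑[ l < m ] (c l * V l j)) * d j) ≈⟨ signedSum-cong (λ j → *-comm _ _) ⟩
    signedSum (λ j → d j * ∑[ l < m ] (c l * V l j))   ≈⟨ signedSum-combination d c V ⟩
    ∑[ l < m ] (c l * signedSum (λ j → d j * V l j))   ≈⟨ ∑-cong (λ l → *-congˡ (signedSum-cong (λ j → *-comm _ _))) ⟩
    ∑[ l < m ] (c l * signedSum (λ j → V l j * d j))   ∎
    where
    d : Fin (suc n) → Carrier
    d j = det n (minor M zero j)
  det-replaceRow-linear (suc n) M (suc i) {m} c V = begin
    det (suc n) (M [ suc i ]≔ v)
      ≈⟨ det-replaceRow-suc n M i v ⟩
    signedSum (λ j → M zero j * det n (minor M zero j [ i ]≔ (v ∘ punchIn j)))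
      ≈⟨ signedSum-cong (λ j → *-congˡ (det-replaceRow-linear n (minor M zero j) i c (λ l → V l ∘ punchIn j))) ⟩
    signedSum (λ j → M zero j * ∑[ l < m ] (c l * det n (minor M zero j [ i ]≔ (V l ∘ punchIn j))))
      ≈⟨ signedSum-combination (M zero) c _ ⟩
    ∑[ l < m ] (c l * signedSum (λ j → M zero j * det n (minor M zero j [ i ]≔ (V l ∘ punchIn j))))
      ≈⟨ ∑-cong (λ l → *-congˡ (det-replaceRow-suc n M i (V l))) ⟨
    ∑[ l < m ] (c l * det (suc n) (M [ suc i ]≔ V l)) ∎
    where
    v : Fin (suc n) → Carrier
    v s = ∑[ l < m ] (c l * V l s)

  punchIn-punchIn : ∀ {c} (j k : Fin (suc c)) (s : Fin c) → toℕ j ≤ toℕ k →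
                    punchIn (inject₁ j) (punchIn k s) ≡ punchIn (suc k) (punchIn j s)
  punchIn-punchIn zero    k       s       j≤k       = ≡.refl
  punchIn-punchIn (suc j) (suc k) zero    j≤k       = ≡.refl
  punchIn-punchIn (suc j) (suc k) (suc s) (s≤s j≤k) = ≡.cong suc (punchIn-punchIn j k s j≤k)

  det-pairExpansion : ∀ n (M : Matrix (suc (suc n))) →
    det (suc (suc n)) M ≈ pairExpansion n (M zero) (M (suc zero)) (λ j k → det n (minor (minor M zero j) zero k))
  det-pairExpansion n M = doubleExpansion-pairExpansion n _ _ _
    (λ j k j≤k → det-cong n (λ r s → reflexive (≡.cong (M (suc (suc r))) (punchIn-punchIn j k s j≤k))))

  swapTop : ∀ {n} → Fin (suc (suc n)) → Fin (suc (suc n))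
  swapTop zero          = suc zero
  swapTop (suc zero)    = zero
  swapTop (suc (suc i)) = suc (suc i)

  det-swapTop : ∀ n (M : Matrix (suc (suc n))) → det (suc (suc n)) (M ∘ swapTop) ≈ - det (suc (suc n)) M
  det-swapTop n M = begin
    det (suc (suc n)) (M ∘ swapTop)              ≈⟨ det-pairExpansion n (M ∘ swapTop) ⟩
    pairExpansion n (M (suc zero)) (M zero) _    ≈⟨ pairExpansion-swap n (M zero) (M (suc zero)) _ ⟩
    - pairExpansion n (M zero) (M (suc zero)) _  ≈⟨ -‿cong (det-pairExpansion n M) ⟨
    - det (suc (suc n)) M                        ∎

  det-equalRows       : ∀ n (M : Matrix n) {i j} → i ≢ j → (∀ s → M i s ≈ M j s) → det n M ≈ 0#
  det-equalRows-below : ∀ n (M : Matrix (suc n)) {i j} → i ≢ j → (∀ s → M (suc i) s ≈ M (suc j) s) →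
                        det (suc n) M ≈ 0#
  det-equalRows-top   : ∀ n (M : Matrix (suc n)) j → (∀ s → M zero s ≈ M (suc j) s) → det (suc n) M ≈ 0#

  det-equalRows (suc n) M {zero}  {zero}  0≢0 _     = ⊥-elim (0≢0 ≡.refl)
  det-equalRows (suc n) M {zero}  {suc j} _   M₀≈Mⱼ = det-equalRows-top n M j M₀≈Mⱼ
  det-equalRows (suc n) M {suc i} {zero}  _   Mᵢ≈M₀ = det-equalRows-top n M i (sym ∘ Mᵢ≈M₀)
  det-equalRows (suc n) M {suc i} {suc j} i≢j Mᵢ≈Mⱼ = det-equalRows-below n M (i≢j ∘ ≡.cong suc) Mᵢ≈Mⱼ

  det-equalRows-below n M i≢j Mᵢ≈Mⱼ = signedSum-zero _ (λ k →
    trans (*-congˡ (det-equalRows n (minor M zero k) i≢j (λ s → Mᵢ≈Mⱼ (punchIn k s)))) (zeroʳ _))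

  det-equalRows-top (suc n) M zero    M₀≈M₁ = trans (det-pairExpansion n M) (pairExpansion-equalRows n _ M₀≈M₁)
  -- After swapping rows 0 and 1 the equal rows are 1 and j + 2, both below the top.
  det-equalRows-top (suc n) M (suc j) M₀≈Mⱼ = begin
    det (suc (suc n)) M
      ≈⟨ -‿involutive _ ⟨
    - - det (suc (suc n)) M
      ≈⟨ -‿cong (det-swapTop n M) ⟨
    - det (suc (suc n)) (M ∘ swapTop)
      ≈⟨ -‿cong (det-equalRows-below (suc n) (M ∘ swapTop) {zero} {suc j} (λ ()) M₀≈Mⱼ) ⟩
    - 0#
      ≈⟨ -0#≈0# ⟩
    0# ∎

  moveToTop : ∀ {n} → Fin (suc n) → Fin (suc n) → Fin (suc n)
  moveToTop r zero    = r
  moveToTop r (suc i) = punchIn r i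

  det-moveToTop : ∀ n (M : Matrix (suc n)) r → det (suc n) (M ∘ moveToTop r) ≈ alt (toℕ r) (det (suc n) M)
  det-moveToTop n M zero = det-cong-rows (suc n) moveToTop-zero
    where
    moveToTop-zero : ∀ i → M (moveToTop zero i) ≡ M i
    moveToTop-zero zero    = ≡.refl
    moveToTop-zero (suc i) = ≡.refl
  -- M ∘ moveToTop (t + 1) is N with rows 0 and 1 swapped, where N keeps row 0 and moves
  -- row t + 1 to position 1 in the minors.
  det-moveToTop (suc n) M (suc t) = begin
    det (suc (suc n)) (M ∘ moveToTop (suc t))
      ≈⟨ det-cong-rows (suc (suc n)) swapped ⟩
    det (suc (suc n)) (N ∘ swapTop)
      ≈⟨ det-swapTop n N ⟩
    - det (suc (suc n)) N
      ≈⟨ -‿cong (signedSum-cong (λ j → *-congˡ (det-moveToTop n (minor M zero j) t))) ⟩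
    - signedSum (λ j → M zero j * alt (toℕ t) (det (suc n) (minor M zero j)))
      ≈⟨ -‿cong (trans (signedSum-cong (λ j → sym (alt-distribʳ-* (toℕ t) _ _))) (signedSum-alt (toℕ t) _)) ⟩
    alt (suc (toℕ t)) (det (suc (suc n)) M) ∎
    where
    N : Matrix (suc (suc n))
    N zero    = M zero
    N (suc i) = M (suc (moveToTop t i))
    swapped : ∀ i → M (moveToTop (suc t) i) ≡ N (swapTop i)
    swapped zero          = ≡.refl
    swapped (suc zero)    = ≡.refl
    swapped (suc (suc i)) = ≡.refl

  det-unitRow : ∀ n (M : Matrix (suc n)) r → M r r ≈ 1# → (∀ j → j ≢ r → M r j ≈ 0#) →
                det (suc n) M ≈ det n (minor M r r)
  det-unitRow n M r Mᵣᵣ≈1 Mᵣⱼ≈0 = begin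
    det (suc n) M
      ≈⟨ alt-involutive (toℕ r) _ ⟨
    alt (toℕ r) (alt (toℕ r) (det (suc n) M))
      ≈⟨ alt-cong (toℕ r) (det-moveToTop n M r) ⟨
    alt (toℕ r) (det (suc n) (M ∘ moveToTop r))
      ≈⟨ alt-cong (toℕ r) (signedSum-single _ r (λ j j≢r → trans (*-congʳ (Mᵣⱼ≈0 j j≢r)) (zeroˡ _))) ⟩
    alt (toℕ r) (alt (toℕ r) (M r r * det n (minor M r r)))
      ≈⟨ alt-involutive (toℕ r) _ ⟩
    M r r * det n (minor M r r)
      ≈⟨ trans (*-congʳ Mᵣᵣ≈1) (*-identityˡ _) ⟩
    det n (minor M r r) ∎

  det-identity : ∀ n (M : Matrix n) → (∀ i → M i i ≈ 1#) → (∀ i j → i ≢ j → M i j ≈ 0#) →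
                 det n M ≈ 1#
  det-identity zero    M diag off = refl
  det-identity (suc n) M diag off = begin
    det (suc n) M
      ≈⟨ signedSum-single _ zero (λ j j≢0 → trans (*-congʳ (off zero j (j≢0 ∘ ≡.sym))) (zeroˡ _)) ⟩
    M zero zero * det n (minor M zero zero)
      ≈⟨ *-cong (diag zero) (det-identity n _ (diag ∘ suc) (λ i j i≢j → off (suc i) (suc j) (i≢j ∘ suc-injective))) ⟩
    1# * 1#
      ≈⟨ *-identityˡ 1# ⟩
    1# ∎

  det-replaceRow-combination : ∀ n (B : Matrix n) (c w : Fin n → Carrier) →
                               (∀ s → w s ≈ ∑[ l < n ] (c l * B l s)) →
                               ∀ j → det n (B [ j ]≔ w) ≈ c j * det n B
  det-replaceRow-combination n B c w w≈cB j = begin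
    det n (B [ j ]≔ w)
      ≈⟨ det-cong n (replaceRow-cong B j w≈cB) ⟩
    det n (B [ j ]≔ (λ s → ∑[ l < n ] (c l * B l s)))
      ≈⟨ det-replaceRow-linear n B j c B ⟩
    ∑[ l < n ] (c l * det n (B [ j ]≔ B l))
      ≈⟨ ∑-single _ j (λ l l≢j → trans (*-congˡ (det-equalRows n _ (l≢j ∘ ≡.sym) (equal l l≢j))) (zeroʳ _)) ⟩
    c j * det n (B [ j ]≔ B j)
      ≈⟨ *-congˡ (det-cong-rows n (updateAt-id-local j B ≡.refl)) ⟩
    c j * det n B ∎
    where
    equal : ∀ l → l ≢ j → ∀ s → (B [ j ]≔ B l) j s ≈ (B [ j ]≔ B l) l s
    equal l l≢j s =
      reflexive (≡.cong (λ row → row s) (≡.trans (updateAt-updates j B) (≡.sym (updateAt-minimal l j B l≢j))))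

  -- By expansion along row 0 and induction on the minors; the terms in which w replaces
  -- row 0 and another row vanish.
  det-rankOne : ∀ n (B : Matrix n) (u w : Fin n → Carrier) →
                det n (λ i s → B i s + u i * w s) ≈ det n B + ∑[ i < n ] (u i * det n (B [ i ]≔ w))
  det-rankOne zero    B u w = sym (trans (+-congˡ (∑-empty _)) (+-identityʳ 1#))
  det-rankOne (suc n) B u w = begin
    det (suc n) (λ i s → B i s + u i * w s)
      ≈⟨ signedSum-cong (λ j → *-congˡ (det-rankOne n (minor B zero j) (u ∘ suc) (w ∘ punchIn j))) ⟩
    signedSum (λ j → (B zero j + u zero * w j) * (D j + E j))
      ≈⟨ signedSum-cong (λ j → expand (B zero j) (u zero) (w j) (D j) (E j)) ⟩
    signedSum (λ j → (B zero j * D j + B zero j * E j) + u zero * (w j * D j + w j * E j))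
      ≈⟨ trans (signedSum-+ _ _) (+-cong (signedSum-+ _ _) (trans (sym (signedSum-*ˡ _ _)) (*-congˡ (signedSum-+ _ _)))) ⟩
    (det (suc n) B + signedSum (λ j → B zero j * E j)) + u zero * (det (suc n) B₀ + signedSum (λ j → w j * E j))
      ≈⟨ +-cong (+-congˡ (cofactors B)) (*-congˡ (+-congˡ (trans (cofactors B₀) (∑-zero _ repeated)))) ⟩
    (det (suc n) B + X) + u zero * (det (suc n) B₀ + 0#)
      ≈⟨ trans (+-congˡ (*-congˡ (+-identityʳ _))) (xy∙z≈x∙zy _ _ _) ⟩
    det (suc n) B + (u zero * det (suc n) B₀ + X)
      ≈⟨ +-congˡ (∑-suc _) ⟨
    det (suc n) B + ∑[ i < suc n ] (u i * det (suc n) (B [ i ]≔ w)) ∎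
    where
    B₀ : Matrix (suc n)
    B₀ = B [ zero ]≔ w
    D E : Fin (suc n) → Carrier
    D j = det n (minor B zero j)
    E j = ∑[ i < n ] (u (suc i) * det n (minor B zero j [ i ]≔ (w ∘ punchIn j)))
    X : Carrier
    X = ∑[ i < n ] (u (suc i) * det (suc n) (B [ suc i ]≔ w))
    expand : ∀ b v x d e → (b + v * x) * (d + e) ≈ (b * d + b * e) + v * (x * d + x * e)
    expand b v x d e = begin
      (b + v * x) * (d + e)             ≈⟨ distribʳ _ _ _ ⟩
      b * (d + e) + v * x * (d + e)     ≈⟨ +-cong (distribˡ _ _ _) (*-assoc _ _ _) ⟩
      (b * d + b * e) + v * (x * (d + e)) ≈⟨ +-congˡ (*-congˡ (distribˡ _ _ _)) ⟩
      (b * d + b * e) + v * (x * d + x * e) ∎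
    cofactors : ∀ (C : Matrix (suc n)) →
      signedSum (λ j → C zero j * ∑[ i < n ] (u (suc i) * det n (minor C zero j [ i ]≔ (w ∘ punchIn j))))
        ≈ ∑[ i < n ] (u (suc i) * det (suc n) (C [ suc i ]≔ w))
    cofactors C = trans (signedSum-combination (C zero) (u ∘ suc) _)
                        (∑-cong (λ i → *-congˡ (sym (det-replaceRow-suc n C i w))))
    repeated : ∀ i → u (suc i) * det (suc n) (B₀ [ suc i ]≔ w) ≈ 0#
    repeated i = trans (*-congˡ (det-equalRows-top n (B₀ [ suc i ]≔ w) i (λ s → reflexive (≡.sym (updated s))))) (zeroʳ _)
      where
      updated : ∀ s → (B₀ [ suc i ]≔ w) (suc i) s ≡ w s
      updated s = ≡.cong (λ row → row s) (updateAt-updates (suc i) B₀)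

module DeterminantHomomorphism {a l b m} (S : CommutativeRing a l) (T : CommutativeRing b m)
  {φ : CommutativeRing.Carrier S → CommutativeRing.Carrier T}
  (φ-isHom : IsRingHomomorphism (CommutativeRing.rawRing S) (CommutativeRing.rawRing T) φ) where
  open CommutativeRing T hiding (zero)
  open IsRingHomomorphism φ-isHom
  private
    module S where
      open FiniteSum S public
      open PS S public using (alt)
      open Determinant S public
    module T where
      open FiniteSum T public
      open PS T public using (alt)
      open Determinant T public

  ∑-homo : ∀ {n} (f : Fin n → CommutativeRing.Carrier S) → φ (S.∑ n f) ≈ T.∑[ i < n ] φ (f i)
  ∑-homo {zero}  f = trans (⟦⟧-cong (S.∑-empty f)) (trans 0#-homo (sym (T.∑-empty _)))
  ∑-homo {suc n} f =
    trans (⟦⟧-cong (S.∑-suc f)) (trans (+-homo _ _) (trans (+-congˡ (∑-homo (f ∘ suc))) (sym (T.∑-suc _))))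

  alt-homo : ∀ k x → φ (S.alt k x) ≈ T.alt k (φ x)
  alt-homo zero    x = refl
  alt-homo (suc k) x = trans (-‿homo _) (-‿cong (alt-homo k x))

  det-homo : ∀ n (M : S.Matrix n) → φ (S.det n M) ≈ T.det n (λ i j → φ (M i j))
  det-homo zero    M = 1#-homo
  det-homo (suc n) M = trans (∑-homo _) (T.∑-cong (λ j → trans (alt-homo (toℕ j) _)
    (Sign.alt-cong T (toℕ j) (trans (*-homo _ _) (*-congˡ (det-homo n (S.minor M zero j)))))))

module _ {a l b m} (S : CommutativeRing a l) (T : CommutativeRing b m) where
  private
    module S = CommutativeRing S
    module T = CommutativeRing T

  isRingHomomorphism : (φ : S.Carrier → T.Carrier) →
    (∀ {x y} → x S.≈ y → φ x T.≈ φ y) →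
    (∀ x y → φ (x S.+ y) T.≈ φ x T.+ φ y) → φ S.0# T.≈ T.0# →
    (∀ x y → φ (x S.* y) T.≈ φ x T.* φ y) → φ S.1# T.≈ T.1# →
    (∀ x → φ (S.- x) T.≈ T.- φ x) →
    IsRingHomomorphism S.rawRing T.rawRing φ
  isRingHomomorphism φ cong +-homo 0#-homo *-homo 1#-homo -‿homo = record
    { isSemiringHomomorphism = record
      { isNearSemiringHomomorphism = record
        { +-isMonoidHomomorphism = record
          { isMagmaHomomorphism = record { isRelHomomorphism = record { cong = cong } ; homo = +-homo }
          ; ε-homo = 0#-homo }
        ; *-homo = *-homo }
      ; 1#-homo = 1#-homo }
    ; -‿homo = -‿homo }

module PowerSeriesRing {c ℓ} (R : CommutativeRing c ℓ) where
  open CommutativeRing R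
  open RingProperties ring using (-‿+-comm; x∙y⁻¹≈ε⇒x≈y)
  open Sign R
  open CommutativeSemigroupProperties +-commutativeSemigroup using (interchange)
  open PS R
  open ≈-Reasoning setoid

  antidiagonal : ℕ → (ℕ → ℕ → Carrier) → Carrier
  antidiagonal zero    F = F 0 0
  antidiagonal (suc k) F = F 0 (suc k) + antidiagonal k (λ i j → F (suc i) j)

  sumUpTo-head : ∀ k f → sumUpTo (suc k) f ≈ f 0 + sumUpTo k (λ i → f (suc i))
  sumUpTo-head zero    f = refl
  sumUpTo-head (suc k) f = trans (+-congʳ (sumUpTo-head k f)) (+-assoc _ _ _)

  sumUpTo-antidiagonal : ∀ k F → sumUpTo k (λ i → F i (k ∸ i)) ≈ antidiagonal k F
  sumUpTo-antidiagonal zero    F = refl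
  sumUpTo-antidiagonal (suc k) F =
    trans (sumUpTo-head k _) (+-congˡ (sumUpTo-antidiagonal k (λ i j → F (suc i) j)))

  ⊗-antidiagonal : ∀ f g k → (f ⊗ g) k ≈ antidiagonal k (λ i j → f i * g j)
  ⊗-antidiagonal f g k = sumUpTo-antidiagonal k (λ i j → f i * g j)

  antidiagonal-cong : ∀ k {F G} → (∀ i j → F i j ≈ G i j) → antidiagonal k F ≈ antidiagonal k G
  antidiagonal-cong zero    F≈G = F≈G 0 0
  antidiagonal-cong (suc k) F≈G = +-cong (F≈G 0 (suc k)) (antidiagonal-cong k (λ i → F≈G (suc i)))

  antidiagonal-+ : ∀ k F G → antidiagonal k (λ i j → F i j + G i j) ≈ antidiagonal k F + antidiagonal k G
  antidiagonal-+ zero    F G = refl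
  antidiagonal-+ (suc k) F G = trans (+-congˡ (antidiagonal-+ k _ _)) (interchange _ _ _ _)

  antidiagonal-*ˡ : ∀ k a F → a * antidiagonal k F ≈ antidiagonal k (λ i j → a * F i j)
  antidiagonal-*ˡ zero    a F = refl
  antidiagonal-*ˡ (suc k) a F = trans (distribˡ _ _ _) (+-congˡ (antidiagonal-*ˡ k a _))

  antidiagonal-neg : ∀ k F → - antidiagonal k F ≈ antidiagonal k (λ i j → - F i j)
  antidiagonal-neg zero    F = refl
  antidiagonal-neg (suc k) F = trans (sym (-‿+-comm _ _)) (+-congˡ (antidiagonal-neg k _))

  antidiagonal-zero : ∀ k F → (∀ i j → i ≤ k → F i j ≈ 0#) → antidiagonal k F ≈ 0#
  antidiagonal-zero zero    F F≈0 = F≈0 0 0 z≤n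
  antidiagonal-zero (suc k) F F≈0 =
    trans (+-cong (F≈0 0 (suc k) z≤n) (antidiagonal-zero k _ (λ i j i≤k → F≈0 (suc i) j (s≤s i≤k))))
          (+-identityʳ 0#)

  antidiagonal-last : ∀ k F → antidiagonal (suc k) F ≈ antidiagonal k (λ i j → F i (suc j)) + F (suc k) 0
  antidiagonal-last zero    F = refl
  antidiagonal-last (suc k) F = begin
    F 0 (suc (suc k)) + antidiagonal (suc k) (λ i j → F (suc i) j)
      ≈⟨ +-congˡ (antidiagonal-last k (λ i j → F (suc i) j)) ⟩
    F 0 (suc (suc k)) + (antidiagonal k (λ i j → F (suc i) (suc j)) + F (suc (suc k)) 0)
      ≈⟨ +-assoc _ _ _ ⟨
    antidiagonal (suc k) (λ i j → F i (suc j)) + F (suc (suc k)) 0 ∎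

  antidiagonal-flip : ∀ k F → antidiagonal k F ≈ antidiagonal k (λ i j → F j i)
  antidiagonal-flip zero    F = refl
  antidiagonal-flip (suc k) F = begin
    F 0 (suc k) + antidiagonal k (λ i j → F (suc i) j) ≈⟨ +-congˡ (antidiagonal-flip k (λ i j → F (suc i) j)) ⟩
    F 0 (suc k) + antidiagonal k (λ i j → F (suc j) i) ≈⟨ +-comm _ _ ⟩
    antidiagonal k (λ i j → F (suc j) i) + F 0 (suc k) ≈⟨ antidiagonal-last k (λ i j → F j i) ⟨
    antidiagonal (suc k) (λ i j → F j i)               ∎

  antidiagonal-assoc : ∀ k (G : ℕ → ℕ → ℕ → Carrier) →
    antidiagonal k (λ m l → antidiagonal m (λ i j → G i j l)) ≈ antidiagonal k (λ i m → antidiagonal m (G i))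
  antidiagonal-assoc zero    G = refl
  antidiagonal-assoc (suc k) G = begin
    G 0 0 (suc k) + antidiagonal k (λ m l → G 0 (suc m) l + antidiagonal m (λ i j → G (suc i) j l))
      ≈⟨ +-congˡ (antidiagonal-+ k _ _) ⟩
    G 0 0 (suc k) + (antidiagonal k (λ m l → G 0 (suc m) l)
                     + antidiagonal k (λ m l → antidiagonal m (λ i j → G (suc i) j l)))
      ≈⟨ +-congˡ (+-congˡ (antidiagonal-assoc k (λ i → G (suc i)))) ⟩
    G 0 0 (suc k) + (antidiagonal k (λ m l → G 0 (suc m) l) + antidiagonal k (λ i m → antidiagonal m (G (suc i))))
      ≈⟨ +-assoc _ _ _ ⟨
    antidiagonal (suc k) (λ i m → antidiagonal m (G i)) ∎

  ⊗-cong : ∀ {f f′ g g′} → f ≋ f′ → g ≋ g′ → (f ⊗ g) ≋ (f′ ⊗ g′)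
  ⊗-cong {f} {f′} {g} {g′} f≋f′ g≋g′ k = begin
    (f ⊗ g) k                          ≈⟨ ⊗-antidiagonal f g k ⟩
    antidiagonal k (λ i j → f i * g j)   ≈⟨ antidiagonal-cong k (λ i j → *-cong (f≋f′ i) (g≋g′ j)) ⟩
    antidiagonal k (λ i j → f′ i * g′ j) ≈⟨ ⊗-antidiagonal f′ g′ k ⟨
    (f′ ⊗ g′) k                        ∎

  ⊗-comm : ∀ f g → (f ⊗ g) ≋ (g ⊗ f)
  ⊗-comm f g k = begin
    (f ⊗ g) k                        ≈⟨ ⊗-antidiagonal f g k ⟩
    antidiagonal k (λ i j → f i * g j) ≈⟨ antidiagonal-flip k _ ⟩
    antidiagonal k (λ i j → f j * g i) ≈⟨ antidiagonal-cong k (λ i j → *-comm _ _) ⟩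
    antidiagonal k (λ i j → g i * f j) ≈⟨ ⊗-antidiagonal g f k ⟨
    (g ⊗ f) k                        ∎

  ⊗-assoc : ∀ f g h → ((f ⊗ g) ⊗ h) ≋ (f ⊗ (g ⊗ h))
  ⊗-assoc f g h k = begin
    ((f ⊗ g) ⊗ h) k
      ≈⟨ ⊗-antidiagonal _ _ k ⟩
    antidiagonal k (λ m l → (f ⊗ g) m * h l)
      ≈⟨ antidiagonal-cong k (λ m l → trans (*-congʳ (⊗-antidiagonal f g m)) (*-comm _ _)) ⟩
    antidiagonal k (λ m l → h l * antidiagonal m (λ i j → f i * g j))
      ≈⟨ antidiagonal-cong k (λ m l → antidiagonal-*ˡ m (h l) _) ⟩
    antidiagonal k (λ m l → antidiagonal m (λ i j → h l * (f i * g j)))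
      ≈⟨ antidiagonal-assoc k (λ i j l → h l * (f i * g j)) ⟩
    antidiagonal k (λ i m → antidiagonal m (λ j l → h l * (f i * g j)))
      ≈⟨ antidiagonal-cong k (λ i m → antidiagonal-cong m (λ j l → trans (*-comm _ _) (*-assoc _ _ _))) ⟩
    antidiagonal k (λ i m → antidiagonal m (λ j l → f i * (g j * h l)))
      ≈⟨ antidiagonal-cong k (λ i m → trans (*-congˡ (⊗-antidiagonal g h m)) (antidiagonal-*ˡ m (f i) _)) ⟨
    antidiagonal k (λ i m → f i * (g ⊗ h) m)
      ≈⟨ ⊗-antidiagonal _ _ k ⟨
    (f ⊗ (g ⊗ h)) k ∎

  ⊗-identityˡ : ∀ f → (𝟙 ⊗ f) ≋ f
  ⊗-identityˡ f zero    = *-identityˡ _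
  ⊗-identityˡ f (suc k) = begin
    (𝟙 ⊗ f) (suc k)
      ≈⟨ ⊗-antidiagonal 𝟙 f (suc k) ⟩
    1# * f (suc k) + antidiagonal k (λ i j → 𝟙 (suc i) * f j)
      ≈⟨ +-cong (*-identityˡ _) (antidiagonal-zero k _ (λ i j _ → zeroˡ _)) ⟩
    f (suc k) + 0#
      ≈⟨ +-identityʳ _ ⟩
    f (suc k) ∎

  ⊗-distribʳ : ∀ f g h → ((g ⊕ h) ⊗ f) ≋ ((g ⊗ f) ⊕ (h ⊗ f))
  ⊗-distribʳ f g h k = begin
    ((g ⊕ h) ⊗ f) k
      ≈⟨ ⊗-antidiagonal _ _ k ⟩
    antidiagonal k (λ i j → (g i + h i) * f j)
      ≈⟨ antidiagonal-cong k (λ i j → distribʳ _ _ _) ⟩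
    antidiagonal k (λ i j → g i * f j + h i * f j)
      ≈⟨ antidiagonal-+ k _ _ ⟩
    antidiagonal k (λ i j → g i * f j) + antidiagonal k (λ i j → h i * f j)
      ≈⟨ +-cong (⊗-antidiagonal g f k) (⊗-antidiagonal h f k) ⟨
    ((g ⊗ f) ⊕ (h ⊗ f)) k ∎

  ⊗-isCommutativeRing : IsCommutativeRing _≋_ _⊕_ _⊗_ ⊖_ 𝟘 𝟙
  ⊗-isCommutativeRing = record
    { isRing = record
      { +-isAbelianGroup = Pointwise.isAbelianGroup ℕ +-isAbelianGroup
      ; *-cong           = ⊗-cong
      ; *-assoc          = ⊗-assoc
      ; *-identity       = ⊗-identityˡ , λ f k → trans (⊗-comm f 𝟙 k) (⊗-identityˡ f k)
      ; distrib          = (λ f g h k → begin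
                              (f ⊗ (g ⊕ h)) k         ≈⟨ ⊗-comm f _ k ⟩
                              ((g ⊕ h) ⊗ f) k         ≈⟨ ⊗-distribʳ f g h k ⟩
                              ((g ⊗ f) ⊕ (h ⊗ f)) k   ≈⟨ +-cong (⊗-comm g f k) (⊗-comm h f k) ⟩
                              ((f ⊗ g) ⊕ (f ⊗ h)) k   ∎)
                         , ⊗-distribʳ
      }
    ; *-comm = ⊗-comm
    }

  powerSeriesRing : CommutativeRing c ℓ
  powerSeriesRing = record { isCommutativeRing = ⊗-isCommutativeRing }

  private
    module ℛ = CommutativeRing powerSeriesRing
    module ℛ-Properties = RingProperties ℛ.ring

  antidiagonal-first : ∀ k F → (∀ i j → F (suc i) j ≈ 0#) → antidiagonal k F ≈ F 0 k
  antidiagonal-first zero    F F≈0 = refl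
  antidiagonal-first (suc k) F F≈0 = trans (+-congˡ (antidiagonal-zero k _ (λ i j _ → F≈0 i j))) (+-identityʳ _)

  const-⊗ : ∀ x f k → (const x ⊗ f) k ≈ x * f k
  const-⊗ x f zero    = refl
  const-⊗ x f (suc k) =
    trans (⊗-antidiagonal _ f (suc k)) (antidiagonal-first (suc k) (λ i j → const x i * f j) (λ i j → zeroˡ _))

  z-⊗-zero : ∀ f → (zPS ⊗ f) 0 ≈ 0#
  z-⊗-zero f = zeroˡ _

  z-⊗-suc : ∀ f k → (zPS ⊗ f) (suc k) ≈ f k
  z-⊗-suc f k = begin
    (zPS ⊗ f) (suc k)
      ≈⟨ ⊗-antidiagonal zPS f (suc k) ⟩
    0# * f (suc k) + antidiagonal k (λ i j → zPS (suc i) * f j)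
      ≈⟨ +-cong (zeroˡ _) (antidiagonal-first k _ (λ i j → zeroˡ _)) ⟩
    0# + 1# * f k
      ≈⟨ trans (+-identityˡ _) (*-identityˡ _) ⟩
    f k ∎

  ⊗-cancelʳ : ∀ f g h → h 0 ≈ 1# → (f ⊗ h) ≋ (g ⊗ h) → f ≋ g
  ⊗-cancelʳ f g h h₀≈1 fh≋gh k = x∙y⁻¹≈ε⇒x≈y _ _ (<-rec (λ k → d k ≈ 0#) step k)
    where
    d : PowerSeries
    d = f ⊕ (⊖ g)
    dh≋0 : (d ⊗ h) ≋ 𝟘
    dh≋0 = ℛ.trans (ℛ.distribʳ h f (⊖ g)) (ℛ.trans (ℛ.+-congˡ (ℛ.sym (ℛ-Properties.-‿distribˡ-* g h)))
             (ℛ.trans (ℛ.+-congʳ fh≋gh) (ℛ.-‿inverseʳ (g ⊗ h))))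
    step : ∀ k → (∀ {i} → i < k → d i ≈ 0#) → d k ≈ 0#
    step zero    _    = begin
      d 0          ≈⟨ trans (*-congˡ h₀≈1) (*-identityʳ _) ⟨
      d 0 * h 0    ≈⟨ dh≋0 0 ⟩
      0#           ∎
    step (suc k) d<≈0 = begin
      d (suc k)
        ≈⟨ trans (*-congˡ h₀≈1) (*-identityʳ _) ⟨
      d (suc k) * h 0
        ≈⟨ +-identityˡ _ ⟨
      0# + d (suc k) * h 0
        ≈⟨ +-congʳ (antidiagonal-zero k _ (λ i j i≤k → trans (*-congʳ (d<≈0 (s≤s i≤k))) (zeroˡ _))) ⟨
      antidiagonal k (λ i j → d i * h (suc j)) + d (suc k) * h 0
        ≈⟨ antidiagonal-last k (λ i j → d i * h j) ⟨
      antidiagonal (suc k) (λ i j → d i * h j)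
        ≈⟨ ⊗-antidiagonal d h (suc k) ⟨
      (d ⊗ h) (suc k)
        ≈⟨ dh≋0 (suc k) ⟩
      0# ∎

  alt-antidiagonal : ∀ k F → alt k (antidiagonal k F) ≈ antidiagonal k (λ i j → alt i (alt j (F i j)))
  alt-antidiagonal zero    F = refl
  alt-antidiagonal (suc k) F = begin
    - alt k (F 0 (suc k) + antidiagonal k F′)
      ≈⟨ -‿cong (alt-+ k _ _) ⟩
    - (alt k (F 0 (suc k)) + alt k (antidiagonal k F′))
      ≈⟨ -‿+-comm _ _ ⟨
    - alt k (F 0 (suc k)) + - alt k (antidiagonal k F′)
      ≈⟨ +-congˡ (trans (-‿cong (alt-antidiagonal k F′)) (antidiagonal-neg k _)) ⟩
    antidiagonal (suc k) (λ i j → alt i (alt j (F i j))) ∎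
    where
    F′ : ℕ → ℕ → Carrier
    F′ i j = F (suc i) j

  alt-*-alt : ∀ i j x y → alt i (alt j (x * y)) ≈ alt i x * alt j y
  alt-*-alt i j x y = begin
    alt i (alt j (x * y))  ≈⟨ alt-cong i (trans (alt-distribʳ-* j x y) (*-comm _ _)) ⟩
    alt i (alt j y * x)    ≈⟨ alt-distribʳ-* i _ _ ⟩
    alt j y * alt i x      ≈⟨ *-comm _ _ ⟩
    alt i x * alt j y      ∎

  atNegZ-isRingHomomorphism : IsRingHomomorphism ℛ.rawRing ℛ.rawRing atNegZ
  atNegZ-isRingHomomorphism = isRingHomomorphism powerSeriesRing powerSeriesRing atNegZ
    (λ f≋g k → alt-cong k (f≋g k))
    (λ f g k → alt-+ k _ _)
    alt-zero
    (λ f g k → begin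
      alt k ((f ⊗ g) k)                                       ≈⟨ alt-cong k (⊗-antidiagonal f g k) ⟩
      alt k (antidiagonal k (λ i j → f i * g j))              ≈⟨ alt-antidiagonal k _ ⟩
      antidiagonal k (λ i j → alt i (alt j (f i * g j)))      ≈⟨ antidiagonal-cong k (λ i j → alt-*-alt i j _ _) ⟩
      antidiagonal k (λ i j → atNegZ f i * atNegZ g j)        ≈⟨ ⊗-antidiagonal _ _ k ⟨
      (atNegZ f ⊗ atNegZ g) k                                 ∎)
    (λ { zero → refl ; (suc k) → alt-zero (suc k) })
    (λ f k → alt-neg k _)

  constantTerm-isRingHomomorphism : IsRingHomomorphism ℛ.rawRing rawRing (λ f → f 0)
  constantTerm-isRingHomomorphism = isRingHomomorphism powerSeriesRing R (λ f → f 0)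
    (λ f≋g → f≋g 0) (λ _ _ → refl) refl (λ _ _ → refl) refl (λ _ → refl)

∃<? : ∀ {p} {P : ℕ → Set p} → Decidable P → ∀ k → Dec (∃ λ i → i < k × P i)
∃<? {P = P} P? k = map′ (λ (t , pt) → toℕ t , toℕ<n t , pt)
                         (λ (i , i<k , pi) → fromℕ< i<k , ≡.subst P (≡.sym (toℕ-fromℕ< i<k)) pi)
                         (any? (λ (t : Fin k) → P? (toℕ t)))

least-witness : ∀ {p} {P : ℕ → Set p} → Decidable P → ∀ {k} → P k →
                ∃ λ j → P j × (∀ {i} → i < j → ¬ P i)
least-witness {p} {P} P? {k} = <-rec (λ k → P k → Least) step k
  where
  Least : Set p
  Least = ∃ λ j → P j × (∀ {i} → i < j → ¬ P i)
  step : ∀ k → (∀ {i} → i < k → P i → Least) → P k → Least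
  step k smaller pk with ∃<? P? k
  ... | yes (i , i<k , pi) = smaller i<k pi
  ... | no  none           = k , pk , λ i<k pi → none (_ , i<k , pi)

deleteVertex : ∀ {n} → Digraph (suc n) → Fin (suc n) → Digraph n
deleteVertex D r i j = D (punchIn r i) (punchIn r j)

deleteVertex-acyclic : ∀ {n} (D : Digraph (suc n)) r → Acyclic D → Acyclic (deleteVertex D r)
deleteVertex-acyclic D r acyclic cycle = acyclic (record
  { m        = m
  ; c        = punchIn r ∘ c
  ; closed   = ≡.cong (punchIn r) closed
  ; edges    = edges
  ; distinct = λ s t eq → distinct s t (punchIn-injective r _ _ eq)
  })
  where open DirectedCycle cycle

-- If every vertex has an out-neighbour `next`, following `next` from vertex 0 eventually
-- revisits a vertex, and the segment between the first revisit and its earlier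
-- occurrence is a directed cycle.
module ForcedWalk {n} (D : Digraph (suc n)) (next : Fin (suc n) → Fin (suc n)) (edge : ∀ v → Edge D v (next v)) where
  open Data.Nat using (_+_)

  walk : ℕ → Fin (suc n)
  walk zero    = zero
  walk (suc k) = next (walk k)

  Revisit : ℕ → Set
  Revisit j = ∃ λ i → i < j × walk i ≡ walk j

  revisit? : Decidable Revisit
  revisit? j = ∃<? (λ i → walk i ≟ walk j) j

  cycle-from : ∀ {i j} → i < j → walk i ≡ walk j → (∀ {j′} → j′ < j → ¬ Revisit j′) →
               DirectedCycle D
  cycle-from {i} {j} i<j wᵢ≡wⱼ first = record { m = m ; c = c ; closed = closed ; edges = edges ; distinct = distinct }
    where
    m : ℕ
    m = j ∸ suc i
    j≡ : suc (i + m) ≡ j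
    j≡ = ℕ.m+[n∸m]≡n i<j
    c : Fin (suc (suc m)) → Fin (suc n)
    c t = walk (i + toℕ t)
    closed : c zero ≡ c (fromℕ (suc m))
    closed = ≡.trans (≡.cong walk (ℕ.+-identityʳ i)) (≡.trans wᵢ≡wⱼ (≡.cong walk (≡.sym last)))
      where
      last : i + toℕ (fromℕ (suc m)) ≡ j
      last = ≡.trans (≡.cong (i +_) (toℕ-fromℕ (suc m))) (≡.trans (ℕ.+-suc i m) j≡)
    edges : ∀ t → Edge D (c (inject₁ t)) (c (suc t))
    edges t = ≡.subst₂ (Edge D) (≡.cong (λ k → walk (i + k)) (≡.sym (toℕ-inject₁ t)))
                                (≡.cong walk (≡.sym (ℕ.+-suc i (toℕ t))))
                                (edge (walk (i + toℕ t)))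
    noRepeat : ∀ {s t} → s < t → t ≤ m → walk (i + s) ≡ walk (i + t) → ⊥
    noRepeat {s} {t} s<t t≤m eq =
      first (≡.subst (i + t <_) j≡ (s≤s (ℕ.+-monoʳ-≤ i t≤m))) (i + s , ℕ.+-monoʳ-< i s<t , eq)
    aligned : ∀ s t → c (inject₁ s) ≡ c (inject₁ t) → walk (i + toℕ s) ≡ walk (i + toℕ t)
    aligned s t = ≡.subst₂ (λ a b → walk (i + a) ≡ walk (i + b)) (toℕ-inject₁ s) (toℕ-inject₁ t)
    distinct : ∀ s t → c (inject₁ s) ≡ c (inject₁ t) → s ≡ t
    distinct s t eq with ℕ.<-cmp (toℕ s) (toℕ t)
    ... | tri< s<t _ _ = ⊥-elim (noRepeat s<t (ℕ.≤-pred (toℕ<n t)) (aligned s t eq))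
    ... | tri≈ _ s≡t _ = toℕ-injective s≡t
    ... | tri> _ _ t<s = ⊥-elim (noRepeat t<s (ℕ.≤-pred (toℕ<n s)) (≡.sym (aligned s t eq)))

  some-revisit : ∃ Revisit
  some-revisit with i , j , i<j , wᵢ≡wⱼ ← pigeonhole (ℕ.n<1+n (suc n)) (walk ∘ toℕ) =
    toℕ j , toℕ i , i<j , wᵢ≡wⱼ

  directedCycle : DirectedCycle D
  directedCycle with j , (i , i<j , wᵢ≡wⱼ) , first ← least-witness revisit? (proj₂ some-revisit) =
    cycle-from i<j wᵢ≡wⱼ first

acyclic⇒sink : ∀ {n} (D : Digraph (suc n)) → Acyclic D → ∃ λ r → ∀ j → D r j ≡ false
acyclic⇒sink D acyclic with any? (λ r → all? (λ j → D r j ≟ᵇ false))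
... | yes sink   = sink
... | no  noSink =
  ⊥-elim (acyclic (ForcedWalk.directedCycle D (proj₁ ∘ successor) (λ r → ¬-not (proj₂ (successor r)))))
  where
  successor : ∀ r → ∃ λ j → ¬ D r j ≡ false
  successor r = ¬∀⟶∃¬ _ _ (λ j → D r j ≟ᵇ false) (λ noEdge → noSink (r , noEdge))

module Walks {c ℓ} (R : CommutativeRing c ℓ) where
  open CommutativeRing R hiding (zero)
  open PS R using (adj; prodX; W)
  open FiniteSum R
  open ≈-Reasoning setoid

  listSum : ∀ {A : Set} → (A → Carrier) → List A → Carrier
  listSum g = foldr (λ v acc → g v + acc) 0#

  listSum-++ : ∀ {A : Set} (g : A → Carrier) xs ys → listSum g (xs ++ ys) ≈ listSum g xs + listSum g ys
  listSum-++ g []       ys = sym (+-identityˡ _)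
  listSum-++ g (v ∷ xs) ys = trans (+-congˡ (listSum-++ g xs ys)) (sym (+-assoc _ _ _))

  listSum-map : ∀ {A B : Set} (g : B → Carrier) (f : A → B) xs → listSum g (map f xs) ≈ listSum (g ∘ f) xs
  listSum-map g f []       = refl
  listSum-map g f (v ∷ xs) = +-congˡ (listSum-map g f xs)

  listSum-cong : ∀ {A : Set} {g h : A → Carrier} → (∀ v → g v ≈ h v) → ∀ xs → listSum g xs ≈ listSum h xs
  listSum-cong g≈h []       = refl
  listSum-cong g≈h (v ∷ xs) = +-cong (g≈h v) (listSum-cong g≈h xs)

  listSum-*ˡ : ∀ {A : Set} a (g : A → Carrier) xs → listSum (λ v → a * g v) xs ≈ a * listSum g xs
  listSum-*ˡ a g []       = sym (zeroʳ a)
  listSum-*ˡ a g (v ∷ xs) = trans (+-congˡ (listSum-*ˡ a g xs)) (sym (distribˡ _ _ _))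

  listSum-concat-tabulate : ∀ {A : Set} k (f : Fin k → List A) (g : A → Carrier) →
                            listSum g (concat (tabulate f)) ≈ ∑[ i < k ] listSum g (f i)
  listSum-concat-tabulate zero    f g = sym (∑-empty _)
  listSum-concat-tabulate (suc k) f g = begin
    listSum g (f zero ++ concat (tabulate (f ∘ suc)))              ≈⟨ listSum-++ g (f zero) _ ⟩
    listSum g (f zero) + listSum g (concat (tabulate (f ∘ suc)))   ≈⟨ +-congˡ (listSum-concat-tabulate k (f ∘ suc) g) ⟩
    listSum g (f zero) + ∑[ i < k ] listSum g (f (suc i))          ≈⟨ ∑-suc _ ⟨
    ∑[ i < suc k ] listSum g (f i)                                 ∎

  listSum-allVecs : ∀ n m (g : Vec (Fin n) (suc m) → Carrier) →
                    listSum g (allVecs n (suc m)) ≈ ∑[ i < n ] listSum (λ v → g (i ∷ v)) (allVecs n m)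
  listSum-allVecs n m g = begin
    listSum g (concat (map vecsFrom (tabulate (λ i → i))))
      ≡⟨ ≡.cong (listSum g ∘ concat) (map-tabulate (λ i → i) vecsFrom) ⟩
    listSum g (concat (tabulate vecsFrom))
      ≈⟨ listSum-concat-tabulate n vecsFrom g ⟩
    ∑[ i < n ] listSum g (vecsFrom i)
      ≈⟨ ∑-cong (λ i → listSum-map g (i ∷_) (allVecs n m)) ⟩
    ∑[ i < n ] listSum (λ v → g (i ∷ v)) (allVecs n m) ∎
    where
    vecsFrom : Fin n → List (Vec (Fin n) (suc m))
    vecsFrom i = map (i ∷_) (allVecs n m)

  module _ {n} (x : Fin n → Carrier) (D : Digraph n) where

    XA : Fin n → Fin n → Carrier
    XA i j = x i * adj D i j

    power : ℕ → (Fin n → Carrier) → Fin n → Carrier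
    power zero    v   = v
    power (suc k) v i = ∑[ j < n ] (XA i j * power k v j)

    rowPower : ℕ → Fin n → Carrier
    rowPower zero    l = 1#
    rowPower (suc k) l = ∑[ i < n ] (rowPower k i * XA i l)

    power-shift : ∀ k v i → power k (power 1 v) i ≈ power (suc k) v i
    power-shift zero    v i = refl
    power-shift (suc k) v i = ∑-cong (λ j → *-congˡ (power-shift k v j))

    rowPower-power : ∀ k v → ∑[ l < n ] (rowPower k l * v l) ≈ ∑[ i < n ] power k v i
    rowPower-power zero    v = ∑-cong (λ l → *-identityˡ _)
    rowPower-power (suc k) v = begin
      ∑[ l < n ] (∑[ i < n ] (rowPower k i * XA i l) * v l)
        ≈⟨ ∑-cong (λ l → trans (∑-*ʳ _ _) (∑-cong (λ i → *-assoc _ _ _))) ⟩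
      ∑[ l < n ] ∑[ i < n ] (rowPower k i * (XA i l * v l))
        ≈⟨ ∑-comm _ ⟩
      ∑[ i < n ] ∑[ l < n ] (rowPower k i * (XA i l * v l))
        ≈⟨ ∑-cong (λ i → ∑-*ˡ _ _) ⟨
      ∑[ i < n ] (rowPower k i * power 1 v i)
        ≈⟨ rowPower-power k (power 1 v) ⟩
      ∑[ i < n ] power k (power 1 v) i
        ≈⟨ ∑-cong (power-shift k v) ⟩
      ∑[ i < n ] power (suc k) v i ∎

    weight : ∀ {m} → Vec (Fin n) m → Carrier
    weight v = if isWalk D v then prodX x v else 0#

    weight-∷ : ∀ {m} i j (v : Vec (Fin n) m) → weight (i ∷ j ∷ v) ≈ XA i j * weight (j ∷ v)
    weight-∷ i j v with D i j | isWalk D (j ∷ v)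
    ... | true  | true  = *-congʳ (sym (*-identityʳ _))
    ... | true  | false = sym (zeroʳ _)
    ... | false | _     = sym (trans (*-congʳ (zeroʳ _)) (zeroˡ _))

    walksFrom : ∀ m i → listSum (λ v → weight (i ∷ v)) (allVecs n m) ≈ power m x i
    walksFrom zero    i = trans (+-identityʳ _) (*-identityʳ _)
    walksFrom (suc m) i = begin
      listSum (λ v → weight (i ∷ v)) (allVecs n (suc m))
        ≈⟨ listSum-allVecs n m _ ⟩
      ∑[ j < n ] listSum (λ v → weight (i ∷ j ∷ v)) (allVecs n m)
        ≈⟨ ∑-cong (λ j → listSum-cong (weight-∷ i j) (allVecs n m)) ⟩
      ∑[ j < n ] listSum (λ v → XA i j * weight (j ∷ v)) (allVecs n m)
        ≈⟨ ∑-cong (λ j → trans (listSum-*ˡ (XA i j) (λ v → weight (j ∷ v)) (allVecs n m)) (*-congˡ (walksFrom m j))) ⟩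
      power (suc m) x i ∎

    W-suc : ∀ k → W x D (suc k) ≈ ∑[ l < n ] (rowPower k l * x l)
    W-suc k = begin
      listSum weight (allVecs n (suc k))                      ≈⟨ listSum-allVecs n k weight ⟩
      ∑[ i < n ] listSum (λ v → weight (i ∷ v)) (allVecs n k) ≈⟨ ∑-cong (walksFrom k) ⟩
      ∑[ i < n ] power k x i                                  ≈⟨ rowPower-power k x ⟨
      ∑[ l < n ] (rowPower k l * x l)                         ∎

module WalkGeneratingFunction {c ℓ} (R : CommutativeRing c ℓ) where
  open PS R
  open PowerSeriesRing R
  private
    module R where
      open CommutativeRing R public
      open RingProperties ring public using (-0#≈0#)
      open FiniteSum R public
      open Determinant R public using (det-identity)
    module ℛ where
      open CommutativeRing powerSeriesRing public
      open RingProperties ring public using (-‿distribˡ-*; -0#≈0#; -‿involutive; x[y-z]≈xy-xz)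
      open CommutativeSemigroupProperties +-commutativeSemigroup public using (x∙yz≈xz∙y)
      open CommutativeSemigroupProperties *-commutativeSemigroup public using (x∙yz≈y∙zx)
    module Laplace = Det 𝟘 𝟙 _⊕_ _⊗_ ⊖_
    module Walk = Walks R
    module atNegZ = IsRingHomomorphism atNegZ-isRingHomomorphism
  open FiniteSum powerSeriesRing
  open Determinant powerSeriesRing
    using (det; det-cong; det-replaceRow-combination; det-rankOne; det-unitRow; minor; _[_]≔_)
  open ≈-Reasoning ℛ.setoid

  detPS≋det : ∀ n (M : Fin n → Fin n → PowerSeries) → detPS n M ≋ det n M
  detPS≋det zero    M = ℛ.refl
  detPS≋det (suc n) M = ℛ.trans (Σᶠ≋∑ (suc n) _) (∑-cong (λ j → ℛ.trans (sgn≋alt (toℕ j) _)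
                          (Sign.alt-cong powerSeriesRing (toℕ j) (ℛ.*-congˡ (detPS≋det n _)))))
    where
    Σᶠ≋∑ : ∀ n (f : Fin n → PowerSeries) → Laplace.Σᶠ n f ≋ ∑ n f
    Σᶠ≋∑ zero    f = ℛ.sym (∑-empty f)
    Σᶠ≋∑ (suc n) f = ℛ.trans (ℛ.+-congˡ (Σᶠ≋∑ n (f ∘ suc))) (ℛ.sym (∑-suc f))
    sgn≋alt : ∀ k f → Laplace.sgn k f ≋ PS.alt powerSeriesRing k f
    sgn≋alt zero    f = ℛ.refl
    sgn≋alt (suc k) f = ℛ.-‿cong (sgn≋alt k f)

  ∑-coefficient : ∀ {n} (G : Fin n → PowerSeries) k → (∑[ l < n ] G l) k R.≈ R.∑ n (λ l → G l k)
  ∑-coefficient {zero}  G k = R.trans (∑-empty G k) (R.sym (R.∑-empty _))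
  ∑-coefficient {suc n} G k =
    R.trans (∑-suc G k) (R.trans (R.+-congˡ (∑-coefficient (G ∘ suc) k)) (R.sym (R.∑-suc _)))

  idPS-diagonal : ∀ {n} (i : Fin n) → idPS i i ≋ 𝟙
  idPS-diagonal i k rewrite dec-true (i ≟ i) ≡.refl = R.refl

  idPS-offDiagonal : ∀ {n} (i j : Fin n) → i ≢ j → idPS i j ≋ 𝟘
  idPS-offDiagonal i j i≢j k rewrite dec-false (i ≟ j) i≢j = R.refl

  const-cong : ∀ {a b} → a R.≈ b → const a ≋ const b
  const-cong a≈b zero    = a≈b
  const-cong a≈b (suc k) = R.refl

  const-zero : const R.0# ≋ 𝟘
  const-zero zero    = R.refl
  const-zero (suc k) = R.refl

  const-difference : ∀ a b → const (a R.- b) ≋ (const a ⊕ (⊖ const b))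
  const-difference a b zero    = R.refl
  const-difference a b (suc k) = R.sym (R.trans (R.+-congˡ R.-0#≈0#) (R.+-identityʳ R.0#))

  *-adj-complement : ∀ {n} (D : Digraph n) a i j → a R.* adj (complement D) i j R.≈ a R.- a R.* adj D i j
  *-adj-complement D a i j with D i j
  ... | true  = R.trans (R.zeroʳ a) (R.sym (R.trans (R.+-congˡ (R.-‿cong (R.*-identityʳ a))) (R.-‿inverseʳ a)))
  ... | false = R.trans (R.*-identityʳ a)
                        (R.sym (R.trans (R.+-congˡ (R.trans (R.-‿cong (R.zeroʳ a)) R.-0#≈0#)) (R.+-identityʳ a)))

  adj-complement-involutive : ∀ {n} (D : Digraph n) i j → adj (complement (complement D)) i j ≡ adj D i j
  adj-complement-involutive D i j = ≡.cong (λ b → if b then R.1# else R.0#) (not-involutive (D i j))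

  module _ {n} (x : Fin n → R.Carrier) (D : Digraph n) where
    private
      B C : Fin n → Fin n → PowerSeries
      B = IminusZXA x D
      C = IplusZXAbar x D
      u : Fin n → PowerSeries
      u i = zPS ⊗ const (x i)
      -- ρ l = (𝟏ᵀ (I − zXA)⁻¹)ₗ
      ρ : Fin n → PowerSeries
      ρ l k = Walk.rowPower x D k l

    C≋B+u𝟙 : ∀ i j → C i j ≋ (B i j ⊕ (u i ⊗ 𝟙))
    C≋B+u𝟙 i j = begin
      idPS i j ⊕ (zPS ⊗ const (x i R.* adj (complement D) i j))
        ≈⟨ ℛ.+-congˡ {idPS i j} (ℛ.*-congˡ {zPS} (ℛ.trans (const-cong (*-adj-complement D (x i) i j))
                                                            (const-difference (x i) a))) ⟩
      idPS i j ⊕ (zPS ⊗ (const (x i) ⊕ (⊖ const a)))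
        ≈⟨ ℛ.+-congˡ {idPS i j} (ℛ.x[y-z]≈xy-xz zPS (const (x i)) (const a)) ⟩
      idPS i j ⊕ (u i ⊕ (⊖ (zPS ⊗ const a)))
        ≈⟨ ℛ.x∙yz≈xz∙y (idPS i j) (u i) _ ⟩
      B i j ⊕ u i
        ≈⟨ ℛ.+-congˡ {B i j} (ℛ.*-identityʳ (u i)) ⟨
      B i j ⊕ (u i ⊗ 𝟙) ∎
      where
      a : R.Carrier
      a = x i R.* adj D i j

    ρB≋𝟙 : ∀ s → 𝟙 ≋ ∑[ l < n ] (ρ l ⊗ B l s)
    ρB≋𝟙 s = ℛ.sym (begin
      ∑[ l < n ] (ρ l ⊗ B l s)
        ≈⟨ ∑-cong split ⟩
      ∑[ l < n ] ((ρ l ⊗ idPS l s) ⊕ (⊖ (zPS ⊗ (m l ⊗ ρ l))))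
        ≈⟨ ∑-+ (λ l → ρ l ⊗ idPS l s) (λ l → ⊖ (zPS ⊗ (m l ⊗ ρ l))) ⟩
      ∑[ l < n ] (ρ l ⊗ idPS l s) ⊕ ∑[ l < n ] (⊖ (zPS ⊗ (m l ⊗ ρ l)))
        ≈⟨ ℛ.+-cong diagonal (ℛ.trans (ℛ.sym (∑-neg (λ l → zPS ⊗ (m l ⊗ ρ l))))
                                      (ℛ.-‿cong (ℛ.sym (∑-*ˡ zPS (λ l → m l ⊗ ρ l))))) ⟩
      ρ s ⊕ (⊖ (zPS ⊗ E))
        ≈⟨ coefficients ⟩
      𝟙 ∎)
      where
      m : Fin n → PowerSeries
      m l = const (Walk.XA x D l s)
      E : PowerSeries
      E = ∑[ l < n ] (m l ⊗ ρ l)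
      split : ∀ l → (ρ l ⊗ B l s) ≋ ((ρ l ⊗ idPS l s) ⊕ (⊖ (zPS ⊗ (m l ⊗ ρ l))))
      split l = ℛ.trans (ℛ.x[y-z]≈xy-xz (ρ l) (idPS l s) (zPS ⊗ m l))
                        (ℛ.+-congˡ {ρ l ⊗ idPS l s} (ℛ.-‿cong (ℛ.x∙yz≈y∙zx (ρ l) zPS (m l))))
      diagonal : ∑[ l < n ] (ρ l ⊗ idPS l s) ≋ ρ s
      diagonal = ℛ.trans (∑-single (λ l → ρ l ⊗ idPS l s) s
                   (λ l l≢s → ℛ.trans (ℛ.*-congˡ {ρ l} (idPS-offDiagonal l s l≢s)) (ℛ.zeroʳ (ρ l))))
                   (ℛ.trans (ℛ.*-congˡ {ρ s} (idPS-diagonal s)) (ℛ.*-identityʳ (ρ s)))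
      -- coefficient k + 1 is the recursion defining rowPower
      coefficients : (ρ s ⊕ (⊖ (zPS ⊗ E))) ≋ 𝟙
      coefficients zero    = R.trans (R.+-congˡ (R.trans (R.-‿cong (z-⊗-zero E)) R.-0#≈0#)) (R.+-identityʳ R.1#)
      coefficients (suc k) = R.trans (R.+-congˡ (R.-‿cong Eₖ)) (R.-‿inverseʳ _)
        where
        Eₖ : (zPS ⊗ E) (suc k) R.≈ Walk.rowPower x D (suc k) s
        Eₖ = R.trans (z-⊗-suc E k) (R.trans (∑-coefficient (λ l → m l ⊗ ρ l) k)
               (R.∑-cong (λ l → R.trans (const-⊗ _ (ρ l) k) (R.*-comm _ _))))

    W≋𝟙+uρ : W x D ≋ (𝟙 ⊕ ∑[ l < n ] (u l ⊗ ρ l))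
    W≋𝟙+uρ zero    = R.sym (R.trans (R.+-congˡ (R.trans (∑-coefficient (λ l → u l ⊗ ρ l) 0)
                       (R.∑-zero _ (λ l → R.trans (R.*-congʳ (z-⊗-zero (const (x l)))) (R.zeroˡ _)))))
                       (R.+-identityʳ R.1#))
    W≋𝟙+uρ (suc k) = R.sym (R.trans (R.+-identityˡ _) (R.trans (∑-coefficient (λ l → u l ⊗ ρ l) (suc k))
                       (R.trans (R.∑-cong term) (R.sym (Walk.W-suc x D k)))))
      where
      term : ∀ l → (u l ⊗ ρ l) (suc k) R.≈ Walk.rowPower x D k l R.* x l
      term l = R.trans (ℛ.*-assoc zPS (const (x l)) (ρ l) (suc k))
                 (R.trans (z-⊗-suc (const (x l) ⊗ ρ l) k) (R.trans (const-⊗ (x l) (ρ l) k) (R.*-comm _ _)))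

    walk-determinant : (W x D ⊗ detPS n B) ≋ detPS n C
    walk-determinant = begin
      W x D ⊗ detPS n B
        ≈⟨ ⊗-cong W≋𝟙+uρ (detPS≋det n B) ⟩
      (𝟙 ⊕ ∑[ l < n ] (u l ⊗ ρ l)) ⊗ det n B
        ≈⟨ ℛ.distribʳ (det n B) 𝟙 _ ⟩
      (𝟙 ⊗ det n B) ⊕ (∑[ l < n ] (u l ⊗ ρ l) ⊗ det n B)
        ≈⟨ ℛ.+-cong (ℛ.*-identityˡ (det n B)) (∑-*ʳ (det n B) (λ l → u l ⊗ ρ l)) ⟩
      det n B ⊕ ∑[ l < n ] ((u l ⊗ ρ l) ⊗ det n B)
        ≈⟨ ℛ.+-congˡ {det n B} (∑-cong cramer) ⟩
      det n B ⊕ ∑[ l < n ] (u l ⊗ det n (B [ l ]≔ 𝟏))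
        ≈⟨ det-rankOne n B u 𝟏 ⟨
      det n (λ i j → B i j ⊕ (u i ⊗ 𝟙))
        ≈⟨ det-cong n C≋B+u𝟙 ⟨
      det n C
        ≈⟨ detPS≋det n C ⟨
      detPS n C ∎
      where
      𝟏 : Fin n → PowerSeries
      𝟏 _ = 𝟙
      cramer : ∀ l → ((u l ⊗ ρ l) ⊗ det n B) ≋ (u l ⊗ det n (B [ l ]≔ 𝟏))
      cramer l = ℛ.trans (ℛ.*-assoc (u l) (ρ l) (det n B))
                   (ℛ.*-congˡ {u l} (ℛ.sym (det-replaceRow-combination n B ρ 𝟏 ρB≋𝟙 l)))

  private
    module atNegZ-det = DeterminantHomomorphism powerSeriesRing powerSeriesRing atNegZ-isRingHomomorphism
    module constantTerm-det = DeterminantHomomorphism powerSeriesRing R constantTerm-isRingHomomorphism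

  detPS-I+zF-constantTerm : ∀ n (F : Fin n → Fin n → PowerSeries) →
                            detPS n (λ i j → idPS i j ⊕ (zPS ⊗ F i j)) 0 R.≈ R.1#
  detPS-I+zF-constantTerm n F =
    R.trans (detPS≋det n _ 0) (R.trans (constantTerm-det.det-homo n _) (R.det-identity n _ diagonal offDiagonal))
    where
    diagonal : ∀ i → idPS i i 0 R.+ (zPS ⊗ F i i) 0 R.≈ R.1#
    diagonal i = R.trans (R.+-cong (idPS-diagonal i 0) (z-⊗-zero (F i i))) (R.+-identityʳ R.1#)
    offDiagonal : ∀ i j → i ≢ j → idPS i j 0 R.+ (zPS ⊗ F i j) 0 R.≈ R.0#
    offDiagonal i j i≢j = R.trans (R.+-cong (idPS-offDiagonal i j i≢j 0) (z-⊗-zero (F i j))) (R.+-identityʳ R.0#)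

  atNegZ-detPS : ∀ n (M N : Fin n → Fin n → PowerSeries) → (∀ i j → atNegZ (M i j) ≋ N i j) →
                 atNegZ (detPS n M) ≋ detPS n N
  atNegZ-detPS n M N M≋N = begin
    atNegZ (detPS n M)              ≈⟨ atNegZ.⟦⟧-cong (detPS≋det n M) ⟩
    atNegZ (det n M)                ≈⟨ atNegZ-det.det-homo n M ⟩
    det n (λ i j → atNegZ (M i j))  ≈⟨ det-cong n M≋N ⟩
    det n N                         ≈⟨ detPS≋det n N ⟨
    detPS n N                       ∎

  atNegZ-idPS : ∀ {n} (i j : Fin n) → atNegZ (idPS i j) ≋ idPS i j
  atNegZ-idPS i j with does (i ≟ j)
  ... | true  = atNegZ.1#-homo
  ... | false = atNegZ.0#-homo

  atNegZ-z : atNegZ zPS ≋ (⊖ zPS)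
  atNegZ-z zero          = R.sym R.-0#≈0#
  atNegZ-z (suc zero)    = R.refl
  atNegZ-z (suc (suc k)) = R.trans (Sign.alt-zero R (suc (suc k))) (R.sym R.-0#≈0#)

  atNegZ-const : ∀ a → atNegZ (const a) ≋ const a
  atNegZ-const a zero    = R.refl
  atNegZ-const a (suc k) = Sign.alt-zero R (suc k)

  atNegZ-z⊗const : ∀ a → atNegZ (zPS ⊗ const a) ≋ (⊖ (zPS ⊗ const a))
  atNegZ-z⊗const a = begin
    atNegZ (zPS ⊗ const a)         ≈⟨ atNegZ.*-homo zPS (const a) ⟩
    atNegZ zPS ⊗ atNegZ (const a)  ≈⟨ ⊗-cong atNegZ-z (atNegZ-const a) ⟩
    (⊖ zPS) ⊗ const a              ≈⟨ ℛ.-‿distribˡ-* zPS (const a) ⟨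
    ⊖ (zPS ⊗ const a)              ∎

  atNegZ-I+zA : ∀ {n} (i j : Fin n) a →
                atNegZ (idPS i j ⊕ (zPS ⊗ const a)) ≋ (idPS i j ⊕ (⊖ (zPS ⊗ const a)))
  atNegZ-I+zA i j a = ℛ.trans (atNegZ.+-homo (idPS i j) _) (ℛ.+-cong (atNegZ-idPS i j) (atNegZ-z⊗const a))

  atNegZ-I-zA : ∀ {n} (i j : Fin n) a →
                atNegZ (idPS i j ⊕ (⊖ (zPS ⊗ const a))) ≋ (idPS i j ⊕ (zPS ⊗ const a))
  atNegZ-I-zA i j a = ℛ.trans (atNegZ.+-homo (idPS i j) _) (ℛ.+-cong (atNegZ-idPS i j) (begin
    atNegZ (⊖ (zPS ⊗ const a))  ≈⟨ atNegZ.-‿homo (zPS ⊗ const a) ⟩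
    ⊖ atNegZ (zPS ⊗ const a)    ≈⟨ ℛ.-‿cong (atNegZ-z⊗const a) ⟩
    ⊖ (⊖ (zPS ⊗ const a))       ≈⟨ ℛ.-‿involutive (zPS ⊗ const a) ⟩
    zPS ⊗ const a               ∎))

  complement-inverse : ∀ {n} (x : Fin n → R.Carrier) (D : Digraph n) →
                       (W x (complement D) ⊗ atNegZ (W x D)) ≋ 𝟙
  complement-inverse {n} x D = ⊗-cancelʳ _ 𝟙 Q̄ (detPS-I+zF-constantTerm n (λ i j → const (zCoefficient i j))) (begin
    (W̄ ⊗ atNegZ W′) ⊗ Q̄         ≈⟨ ℛ.*-assoc W̄ (atNegZ W′) Q̄ ⟩
    W̄ ⊗ (atNegZ W′ ⊗ Q̄)         ≈⟨ ℛ.*-congˡ {W̄} (ℛ.*-congˡ {atNegZ W′} atNegZ-P) ⟨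
    W̄ ⊗ (atNegZ W′ ⊗ atNegZ P)  ≈⟨ ℛ.*-congˡ {W̄} (atNegZ.*-homo W′ P) ⟨
    W̄ ⊗ atNegZ (W′ ⊗ P)         ≈⟨ ℛ.*-congˡ {W̄} (atNegZ.⟦⟧-cong (walk-determinant x D)) ⟩
    W̄ ⊗ atNegZ Q                ≈⟨ ℛ.*-congˡ {W̄} atNegZ-Q ⟩
    W̄ ⊗ P̄                       ≈⟨ walk-determinant x (complement D) ⟩
    Q̄                           ≈⟨ ℛ.*-identityˡ Q̄ ⟨
    𝟙 ⊗ Q̄                       ∎)
    where
    zCoefficient : Fin n → Fin n → R.Carrier
    zCoefficient i j = x i R.* adj (complement (complement D)) i j
    W′ W̄ P Q P̄ Q̄ : PowerSeries
    W′ = W x D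
    W̄ = W x (complement D)
    P = detPS n (IminusZXA x D)
    Q = detPS n (IplusZXAbar x D)
    P̄ = detPS n (IminusZXA x (complement D))
    Q̄ = detPS n (IplusZXAbar x (complement D))
    atNegZ-Q : atNegZ Q ≋ P̄
    atNegZ-Q = atNegZ-detPS n _ _ (λ i j → atNegZ-I+zA i j _)
    atNegZ-P : atNegZ P ≋ Q̄
    atNegZ-P = atNegZ-detPS n _ _ (λ i j → ℛ.trans (atNegZ-I-zA i j _) (ℛ.+-congˡ {idPS i j} (ℛ.*-congˡ {zPS}
                 (const-cong (R.reflexive (≡.cong (x i R.*_) (≡.sym (adj-complement-involutive D i j))))))))

  idPS-punchIn : ∀ {n} (r : Fin (suc n)) i j → idPS (punchIn r i) (punchIn r j) ≋ idPS i j
  idPS-punchIn r i j with i ≟ j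
  ... | yes ≡.refl = idPS-diagonal (punchIn r i)
  ... | no  i≢j    = idPS-offDiagonal _ _ (i≢j ∘ punchIn-injective r i j)

  acyclic⇒detPS-I-zXA : ∀ n (x : Fin n → R.Carrier) (D : Digraph n) → Acyclic D →
                        detPS n (IminusZXA x D) ≋ 𝟙
  acyclic⇒detPS-I-zXA zero    x D acyclic = ℛ.refl
  acyclic⇒detPS-I-zXA (suc n) x D acyclic with r , sink ← acyclic⇒sink D acyclic = begin
    detPS (suc n) B
      ≈⟨ detPS≋det (suc n) B ⟩
    det (suc n) B
      ≈⟨ det-unitRow n B r (ℛ.trans (sinkRow r) (idPS-diagonal r))
                           (λ j j≢r → ℛ.trans (sinkRow j) (idPS-offDiagonal r j (j≢r ∘ ≡.sym))) ⟩
    det n (minor B r r)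
      ≈⟨ det-cong n (λ i j → ℛ.+-congʳ (idPS-punchIn r i j)) ⟩
    det n (IminusZXA (x ∘ punchIn r) (deleteVertex D r))
      ≈⟨ detPS≋det n _ ⟨
    detPS n (IminusZXA (x ∘ punchIn r) (deleteVertex D r))
      ≈⟨ acyclic⇒detPS-I-zXA n _ _ (deleteVertex-acyclic D r acyclic) ⟩
    𝟙 ∎
    where
    B : Fin (suc n) → Fin (suc n) → PowerSeries
    B = IminusZXA x D
    noEdge : ∀ j → x r R.* adj D r j R.≈ R.0#
    noEdge j = R.trans (R.reflexive (≡.cong (λ b → x r R.* (if b then R.1# else R.0#)) (sink j))) (R.zeroʳ (x r))
    sinkRow : ∀ j → B r j ≋ idPS r j
    sinkRow j = begin
      idPS r j ⊕ (⊖ (zPS ⊗ const (x r R.* adj D r j)))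
        ≈⟨ ℛ.+-congˡ {idPS r j} (ℛ.-‿cong (ℛ.*-congˡ {zPS} (ℛ.trans (const-cong (noEdge j)) const-zero))) ⟩
      idPS r j ⊕ (⊖ (zPS ⊗ 𝟘))
        ≈⟨ ℛ.+-congˡ {idPS r j} (ℛ.trans (ℛ.-‿cong (ℛ.zeroʳ zPS)) ℛ.-0#≈0#) ⟩
      idPS r j ⊕ 𝟘
        ≈⟨ ℛ.+-identityʳ (idPS r j) ⟩
      idPS r j ∎

  acyclic-walks : ∀ {n} (x : Fin n → R.Carrier) (D : Digraph n) → Acyclic D →
                  W x D ≋ detPS n (IplusZXAbar x D)
  acyclic-walks {n} x D acyclic = begin
    W x D                            ≈⟨ ℛ.*-identityʳ (W x D) ⟨
    W x D ⊗ 𝟙                        ≈⟨ ℛ.*-congˡ {W x D} (acyclic⇒detPS-I-zXA n x D acyclic) ⟨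
    W x D ⊗ detPS n (IminusZXA x D)  ≈⟨ walk-determinant x D ⟩
    detPS n (IplusZXAbar x D)        ∎

lemma1 : ∀ {c ℓ} (R : CommutativeRing c ℓ) (n : ℕ)
           (x : Fin n → CommutativeRing.Carrier R) (D : Digraph n) →
           let open PS R in
           ((W x D ⊗ detPS n (IminusZXA x D)) ≋ detPS n (IplusZXAbar x D))
           × ((W x (complement D) ⊗ atNegZ (W x D)) ≋ 𝟙)
           × (Acyclic D → W x D ≋ detPS n (IplusZXAbar x D))
lemma1 R n x D = walk-determinant x D , complement-inverse x D , acyclic-walks x D
  where open WalkGeneratingFunction R
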